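{- There is a recursive pre-Eulerian graph $G$ such that $0'$ is recursive in every Euler path through $G$.
   Context: A graph $G=\langle V,E\rangle$ has vertex set $V\subseteq\mathbb{N}$ and edge set $E$ a set of unordered pairs of elements of $V$. A path in $G$ is a sequence of vertices $v_0,v_1,v_2,\dots$ (indexed by $\mathbb{N}$) such that $(v_i,v_{i+1})\in E$ for every $i$; it is an Euler path if it uses every edge of $G$ exactly once. For a subgraph $H$ of $G$, $G-H$ is the graph obtained from $G$ by deleting the edges of $H$. $G$ is pre-Eulerian if (1) $G$ is connected, (2) $G$ has at most one vertex of odd degree, (3) if $G$ has no vertex of odd degree then it has at least one vertex of infinite degree, and (4) for every finite subgraph $H$ of $G$, $G-H$ has exactly one infinite connected component. $0'$ denotes the halting set. -}

module Defs where

open import Data.Nat using (ℕ; zero; suc; _+_; _*_; _≤_; _<_)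
open import Data.Bool using (Bool; true; false)
import Data.Product
open import Data.Sum using (_⊎_)
open Data.Product using (Σ; ∃; _×_; _,_)
open import Data.List using (List; length)
open import Data.List.Membership.Propositional using (_∈_)
open import Data.List.Relation.Unary.All using (All)
open import Data.List.Relation.Unary.Unique.Propositional using (Unique)
open import Relation.Nullary using (¬_)
open import Relation.Binary.PropositionalEquality using (_≡_)
open import Relation.Binary.Construct.Closure.ReflexiveTransitive using (Star)

tri : ℕ → ℕ
tri zero    = zero
tri (suc s) = tri s + suc s

⟪_,_⟫ : ℕ → ℕ → ℕ
⟪ a , b ⟫ = tri (a + b) + b

data PR : Set where
  zer   : PR
  succ  : PR
  ident : PR
  fst   : PR
  snd   : PR
  orc   : PR
  comp  : PR → PR → PR
  pair  : PR → PR → PR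
  prec  : PR → PR → PR
  mu    : PR → PR

data Eval (X : ℕ → ℕ) : PR → ℕ → ℕ → Set where
  e-zer   : ∀ n → Eval X zer n 0
  e-succ  : ∀ n → Eval X succ n (suc n)
  e-ident : ∀ n → Eval X ident n n
  e-fst   : ∀ a b → Eval X fst ⟪ a , b ⟫ a
  e-snd   : ∀ a b → Eval X snd ⟪ a , b ⟫ b
  e-orc   : ∀ n → Eval X orc n (X n)
  e-comp  : ∀ {f g n k m} → Eval X g n k → Eval X f k m → Eval X (comp f g) n m
  e-pair  : ∀ {f g n a b} → Eval X f n a → Eval X g n b → Eval X (pair f g) n ⟪ a , b ⟫
  e-prec0 : ∀ {f g x m} → Eval X f x m → Eval X (prec f g) ⟪ x , 0 ⟫ m
  e-precS : ∀ {f g x n k m} → Eval X (prec f g) ⟪ x , n ⟫ k →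
            Eval X g ⟪ x , ⟪ n , k ⟫ ⟫ m → Eval X (prec f g) ⟪ x , suc n ⟫ m
  e-mu    : ∀ {f x y} → Eval X f ⟪ x , y ⟫ 0 →
            (∀ z → z < y → Σ ℕ (λ k → Eval X f ⟪ x , z ⟫ (suc k))) →
            Eval X (mu f) x y

-- the empty oracle (used for unrelativised computation)
noOracle : ℕ → ℕ
noOracle _ = 0

enc : PR → ℕ
enc zer        = ⟪ 0 , 0 ⟫
enc succ       = ⟪ 1 , 0 ⟫
enc ident      = ⟪ 2 , 0 ⟫
enc fst        = ⟪ 3 , 0 ⟫
enc snd        = ⟪ 4 , 0 ⟫
enc orc        = ⟪ 5 , 0 ⟫
enc (comp f g) = ⟪ 6 , ⟪ enc f , enc g ⟫ ⟫
enc (pair f g) = ⟪ 7 , ⟪ enc f , enc g ⟫ ⟫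
enc (prec f g) = ⟪ 8 , ⟪ enc f , enc g ⟫ ⟫
enc (mu f)     = ⟪ 9 , enc f ⟫

HaltingSet : ℕ → Set
HaltingSet e = Σ PR (λ c → enc c ≡ e × Σ ℕ (λ m → Eval noOracle c e m))

b2n : Bool → ℕ
b2n true  = 1
b2n false = 0

RecursiveIn : (ℕ → Set) → (ℕ → ℕ) → Set
RecursiveIn A X = Σ PR (λ c → ∀ n → (A n → Eval X c n 1) × (¬ A n → Eval X c n 0))

RecursiveFun : (ℕ → ℕ) → Set
RecursiveFun f = Σ PR (λ c → ∀ n → Eval noOracle c n (f n))

-- V ⊆ ℕ and E a set of unordered pairs of (distinct) elements of V,
-- given by characteristic functions
record Graph : Set where
  field
    V      : ℕ → Bool
    E      : ℕ → ℕ → Bool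
    E-sym  : ∀ u v → E u v ≡ E v u
    E-irr  : ∀ u → E u u ≡ false
    E-V    : ∀ u v → E u v ≡ true → V u ≡ true

open Graph public

Vtx : Graph → ℕ → Set
Vtx G v = V G v ≡ true

Adj : Graph → ℕ → ℕ → Set
Adj G u v = E G u v ≡ true

RecursiveGraph : Graph → Set
RecursiveGraph G = RecursiveFun (λ n → b2n (V G n))
                 × Σ PR (λ c → ∀ a b → Eval noOracle c ⟪ a , b ⟫ (b2n (E G a b)))

Odd : ℕ → Set
Odd n = Σ ℕ (λ k → n ≡ suc (2 * k))

HasDegree : Graph → ℕ → ℕ → Set
HasDegree G v n = Σ (List ℕ) (λ l → Unique l × length l ≡ n ×
                    (∀ u → (u ∈ l → Adj G v u) × (Adj G v u → u ∈ l)))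

InfiniteDegree : Graph → ℕ → Set
InfiniteDegree G v = ∀ k → Σ ℕ (λ u → k ≤ u × Adj G v u)

HasOddDegree : Graph → ℕ → Set
HasOddDegree G v = Σ ℕ (λ n → HasDegree G v n × Odd n)

-- finite subgraphs (for edge deletion only their edges matter): finite lists of edges of G
FiniteSubgraph : Graph → Set
FiniteSubgraph G = Σ (List (ℕ × ℕ)) (λ H → All (λ e → Adj G (Data.Product.proj₁ e) (Data.Product.proj₂ e)) H)

AdjMinus : (G : Graph) → List (ℕ × ℕ) → ℕ → ℕ → Set
AdjMinus G H u v = Adj G u v × ¬ ((u , v) ∈ H) × ¬ ((v , u) ∈ H)

InInfiniteComponent : (G : Graph) → List (ℕ × ℕ) → ℕ → Set
InInfiniteComponent G H v = ∀ k → Σ ℕ (λ u → k ≤ u × Vtx G u × Star (AdjMinus G H) v u)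

Connected : Graph → Set
Connected G = ∀ u v → Vtx G u → Vtx G v → Star (Adj G) u v

PreEulerian : Graph → Set
PreEulerian G =
    Connected G
  × (∀ u v → Vtx G u → Vtx G v → HasOddDegree G u → HasOddDegree G v → u ≡ v)
  × ((∀ v → Vtx G v → ¬ HasOddDegree G v) → Σ ℕ (λ v → Vtx G v × InfiniteDegree G v))
  × (∀ (H : FiniteSubgraph G) → let h = Data.Product.proj₁ H in
       Σ ℕ (λ v → Vtx G v × InInfiniteComponent G h v ×
         (∀ w → Vtx G w → InInfiniteComponent G h w → Star (AdjMinus G h) v w)))

SameEdge : ℕ → ℕ → ℕ → ℕ → Set
SameEdge a b u v = (a ≡ u × b ≡ v) ⊎ (a ≡ v × b ≡ u)

EulerPath : Graph → (ℕ → ℕ) → Set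
EulerPath G p =
    (∀ i → Adj G (p i) (p (suc i)))
  × (∀ u v → Adj G u v →
       Σ ℕ (λ i → SameEdge (p i) (p (suc i)) u v ×
         (∀ j → SameEdge (p j) (p (suc j)) u v → j ≡ i)))

-- The graph is a ray r₀ – r₁ – r₂ – ⋯ on which, for every program e that halts, a triangle
-- r_{e+1} – g – g′ is hung.  The vertices g and g′ record the exact stage s at which a universal
-- machine sees e halt, which makes vertices and edges decidable although 0′ is not.  Every
-- vertex except r₀ has even degree, and deleting finitely many edges leaves the far end of the
-- ray as the only infinite component, so the graph is pre-Eulerian.
--
-- An Euler path starts at the unique odd vertex r₀.  Once it has crossed the bridge
-- r_{e+1} – r_{e+2} it never comes back to r_{e+1}, so if e halts the path has to meet the
-- triangle of e, which lies at level e + 2, before it first reaches r_{e+2}.  Hence e ∈ 0′ iff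
-- the first vertex of level e + 2 on the path is not r_{e+2}, and the path computes 0′.
--
-- Halting within s steps is decided by iterating the transition function of a stack machine
-- for PR codes, written in a small expression language that compiles to PR; the machine is
-- sound because a semantic invariant of its states is preserved backwards along steps.

module Submission where

open import Defs
open import Data.Bool using (Bool; true; false; T; _∧_; _∨_; not)
open import Data.Bool.Properties using (T-∧; T-∨; T-≡; ∨-comm; ∧-identityʳ)
open import Data.Empty using (⊥; ⊥-elim)
open import Data.List using (List; []; _∷_; length; filter; upTo)
open import Data.List.Membership.Propositional using (_∈_; _∉_; find; lose)
open import Data.List.Membership.Propositional.Properties using (∈-filter⁺; ∈-upTo⁺)
open import Data.List.Membership.Propositional.Properties.WithK using (unique∧set⇒bag)
open import Data.List.Properties using (filter-notAll; length-upTo)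
open import Data.List.Relation.Binary.BagAndSetEquality using (∼bag⇒↭)
open import Data.List.Relation.Binary.Permutation.Propositional.Properties using (↭-length)
open import Data.List.Relation.Unary.All using ([]; _∷_)
open import Data.List.Relation.Unary.AllPairs using ([]; _∷_)
import Data.List.Relation.Unary.Any as Any
open import Data.List.Relation.Unary.Any using (here; there; any?)
open import Data.List.Relation.Unary.Unique.Propositional using (Unique)
open import Data.Nat using (ℕ; zero; suc; _+_; _*_; _∸_; _≤_; _<_; z≤n; s≤s; pred; _≡ᵇ_; _≤ᵇ_)
open import Data.Nat.GeneralisedArithmetic using (fold; fold-+)
open import Data.Nat.Properties
open import Data.List.Membership.DecPropositional _≟_ using (_∈?_)
open import Data.Product using (Σ; _×_; _,_; proj₁; proj₂)
open import Data.Sum using (_⊎_; inj₁; inj₂; swap)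
open import Function using (_∘_; id)
open import Function.Bundles using (Equivalence; mk⇔)
open import Relation.Binary.Construct.Closure.ReflexiveTransitive using (Star; ε; _◅_; _◅◅_; reverse)
open import Relation.Binary.Definitions using (tri<; tri≈; tri>)
open import Relation.Binary.PropositionalEquality hiding (J)
open import Relation.Nullary using (¬_; yes; no; Dec)
open import Relation.Nullary.Decidable using (¬?; dec-true; dec-false)

unpairStep : ℕ × ℕ → ℕ × ℕ
unpairStep (zero  , b) = suc b , 0
unpairStep (suc a , b) = a , suc b

unpair : ℕ → ℕ × ℕ
unpair zero    = 0 , 0
unpair (suc n) = unpairStep (unpair n)

⟪⟫-unpairStep : ∀ p → let (a′ , b′) = unpairStep p in ⟪ a′ , b′ ⟫ ≡ suc ⟪ proj₁ p , proj₂ p ⟫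
⟪⟫-unpairStep (zero , b) rewrite +-identityʳ b | +-identityʳ (tri b + suc b) = +-suc (tri b) b
⟪⟫-unpairStep (suc a , b) rewrite +-suc a b = +-suc (tri (suc (a + b))) b

⟪⟫-unpair : ∀ n → ⟪ proj₁ (unpair n) , proj₂ (unpair n) ⟫ ≡ n
⟪⟫-unpair zero    = refl
⟪⟫-unpair (suc n) = trans (⟪⟫-unpairStep (unpair n)) (cong suc (⟪⟫-unpair n))

unpair-tri+ : ∀ s b → b ≤ s → unpair (tri s + b) ≡ (s ∸ b , b)
unpair-tri+ zero    zero    z≤n = refl
unpair-tri+ (suc s) zero    z≤n
  rewrite +-identityʳ (tri s + suc s) | +-suc (tri s) s | unpair-tri+ s s ≤-refl | n∸n≡0 s = refl
unpair-tri+ s       (suc b) b<s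
  rewrite +-suc (tri s) b | unpair-tri+ s b (<⇒≤ b<s) | +-∸-assoc 1 b<s = refl

unpair-⟪⟫ : ∀ a b → unpair ⟪ a , b ⟫ ≡ (a , b)
unpair-⟪⟫ a b rewrite unpair-tri+ (a + b) b (m≤n+m b a) | m+n∸n≡m a b = refl

tri-mono-≤ : ∀ {m n} → m ≤ n → tri m ≤ tri n
tri-mono-≤ z≤n       = z≤n
tri-mono-≤ (s≤s m≤n) = +-mono-≤ (tri-mono-≤ m≤n) (s≤s m≤n)

n≤tri[n] : ∀ n → n ≤ tri n
n≤tri[n] zero    = z≤n
n≤tri[n] (suc n) = m≤n+m (suc n) (tri n)

-- Opaque, so that goals never unfold the Cantor polynomial.
opaque
  ⟨_,_⟩ : ℕ → ℕ → ℕ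
  ⟨ a , b ⟩ = ⟪ a , b ⟫

  π₁ π₂ : ℕ → ℕ
  π₁ n = proj₁ (unpair n)
  π₂ n = proj₂ (unpair n)

  ⟨⟩≡⟪⟫ : ∀ a b → ⟨ a , b ⟩ ≡ ⟪ a , b ⟫
  ⟨⟩≡⟪⟫ a b = refl

  π₁-⟨⟩ : ∀ a b → π₁ ⟨ a , b ⟩ ≡ a
  π₁-⟨⟩ a b = cong proj₁ (unpair-⟪⟫ a b)

  π₂-⟨⟩ : ∀ a b → π₂ ⟨ a , b ⟩ ≡ b
  π₂-⟨⟩ a b = cong proj₂ (unpair-⟪⟫ a b)

  ⟨π₁,π₂⟩ : ∀ n → ⟨ π₁ n , π₂ n ⟩ ≡ n
  ⟨π₁,π₂⟩ = ⟪⟫-unpair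

  ⟨0,0⟩≡0 : ⟨ 0 , 0 ⟩ ≡ 0
  ⟨0,0⟩≡0 = refl

  ≤-⟨⟩ˡ : ∀ a b → a ≤ ⟨ a , b ⟩
  ≤-⟨⟩ˡ a b = ≤-trans (m≤m+n a b) (≤-trans (n≤tri[n] (a + b)) (m≤m+n _ b))

  ⟨_,0⟩-mono-≤ : ∀ {a a′} → a ≤ a′ → ⟨ a , 0 ⟩ ≤ ⟨ a′ , 0 ⟩
  ⟨_,0⟩-mono-≤ a≤a′ = +-monoˡ-≤ 0 (tri-mono-≤ (+-monoˡ-≤ 0 a≤a′))

⟨⟩-injectiveˡ : ∀ {a b c d} → ⟨ a , b ⟩ ≡ ⟨ c , d ⟩ → a ≡ c
⟨⟩-injectiveˡ {a} {b} {c} {d} eq = trans (sym (π₁-⟨⟩ a b)) (trans (cong π₁ eq) (π₁-⟨⟩ c d))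

⟨⟩-injectiveʳ : ∀ {a b c d} → ⟨ a , b ⟩ ≡ ⟨ c , d ⟩ → b ≡ d
⟨⟩-injectiveʳ {a} {b} {c} {d} eq = trans (sym (π₂-⟨⟩ a b)) (trans (cong π₂ eq) (π₂-⟨⟩ c d))

π₂-0 : π₂ 0 ≡ 0
π₂-0 = subst (λ n → π₂ n ≡ 0) ⟨0,0⟩≡0 (π₂-⟨⟩ 0 0)

⟨⟩-elim : (Q : ℕ → Set) → (∀ a b → Q ⟨ a , b ⟩) → ∀ n → Q n
⟨⟩-elim Q h n = subst Q (⟨π₁,π₂⟩ n) (h (π₁ n) (π₂ n))

π₁-⟪⟫ : ∀ a b → π₁ ⟪ a , b ⟫ ≡ a
π₁-⟪⟫ a b = subst (λ n → π₁ n ≡ a) (⟨⟩≡⟪⟫ a b) (π₁-⟨⟩ a b)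

π₂-⟪⟫ : ∀ a b → π₂ ⟪ a , b ⟫ ≡ b
π₂-⟪⟫ a b = subst (λ n → π₂ n ≡ b) (⟨⟩≡⟪⟫ a b) (π₂-⟨⟩ a b)

⟨⟩²≡⟪⟫² : ∀ a b c → ⟨ a , ⟨ b , c ⟩ ⟩ ≡ ⟪ a , ⟪ b , c ⟫ ⟫
⟨⟩²≡⟪⟫² a b c = trans (⟨⟩≡⟪⟫ a _) (cong ⟪ a ,_⟫ (⟨⟩≡⟪⟫ b c))

ifZero : {A : Set} → ℕ → A → A → A
ifZero zero    a b = a
ifZero (suc _) a b = b

infixr 9 _∘ᵉ_

data Expr : Set where
  argᵉ    : Expr
  litᵉ    : ℕ → Expr
  sucᵉ    : Expr → Expr
  π₁ᵉ π₂ᵉ : Expr → Expr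
  ⟨_,_⟩ᵉ  : Expr → Expr → Expr
  _∘ᵉ_    : Expr → Expr → Expr
  ifZeroᵉ : Expr → Expr → Expr → Expr
  _∸ᵉ_    : Expr → Expr → Expr
  foldᵉ   : Expr → Expr → Expr → Expr
  oracleᵉ : Expr → Expr

⟦_⟧ : Expr → (ℕ → ℕ) → ℕ → ℕ
⟦ argᵉ            ⟧ X x = x
⟦ litᵉ n          ⟧ X x = n
⟦ sucᵉ t          ⟧ X x = suc (⟦ t ⟧ X x)
⟦ π₁ᵉ t           ⟧ X x = π₁ (⟦ t ⟧ X x)
⟦ π₂ᵉ t           ⟧ X x = π₂ (⟦ t ⟧ X x)
⟦ ⟨ t , u ⟩ᵉ      ⟧ X x = ⟨ ⟦ t ⟧ X x , ⟦ u ⟧ X x ⟩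
⟦ t ∘ᵉ u          ⟧ X x = ⟦ t ⟧ X (⟦ u ⟧ X x)
⟦ ifZeroᵉ t u v   ⟧ X x = ifZero (⟦ t ⟧ X x) (⟦ u ⟧ X x) (⟦ v ⟧ X x)
⟦ t ∸ᵉ u          ⟧ X x = ⟦ t ⟧ X x ∸ ⟦ u ⟧ X x
⟦ foldᵉ t u v     ⟧ X x = fold (⟦ t ⟧ X x) (⟦ u ⟧ X) (⟦ v ⟧ X x)
⟦ oracleᵉ t       ⟧ X x = X (⟦ t ⟧ X x)

primRec : (ℕ → ℕ) → (ℕ → ℕ → ℕ → ℕ) → ℕ → ℕ → ℕ
primRec f g x zero    = f x
primRec f g x (suc n) = g x n (primRec f g x n)

predPR : PR
predPR = comp (prec zer (comp fst snd)) (pair zer ident)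

compile : Expr → PR
compile argᵉ             = ident
compile (litᵉ zero)      = zer
compile (litᵉ (suc n))   = comp succ (compile (litᵉ n))
compile (sucᵉ t)         = comp succ (compile t)
compile (π₁ᵉ t)          = comp fst (compile t)
compile (π₂ᵉ t)          = comp snd (compile t)
compile ⟨ t , u ⟩ᵉ       = pair (compile t) (compile u)
compile (t ∘ᵉ u)         = comp (compile t) (compile u)
compile (ifZeroᵉ t u v)  = comp (prec (compile u) (comp (compile v) fst)) (pair ident (compile t))
compile (t ∸ᵉ u)         = comp (prec ident (comp predPR (comp snd snd))) (pair (compile t) (compile u))
compile (foldᵉ t u v)    = comp (prec (compile t) (comp (compile u) (comp snd snd))) (pair ident (compile v))
compile (oracleᵉ t)      = comp orc (compile t)

module _ {X : ℕ → ℕ} where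

  eval-⟨⟩ : ∀ {c n a b} → Eval X c n ⟪ a , b ⟫ → Eval X c n ⟨ a , b ⟩
  eval-⟨⟩ {a = a} {b} = subst (Eval X _ _) (sym (⟨⟩≡⟪⟫ a b))

  eval-π₁ : ∀ n → Eval X fst n (π₁ n)
  eval-π₁ = ⟨⟩-elim (λ n → Eval X fst n (π₁ n))
    (λ a b → subst₂ (Eval X fst) (sym (⟨⟩≡⟪⟫ a b)) (sym (π₁-⟨⟩ a b)) (e-fst a b))

  eval-π₂ : ∀ n → Eval X snd n (π₂ n)
  eval-π₂ = ⟨⟩-elim (λ n → Eval X snd n (π₂ n))
    (λ a b → subst₂ (Eval X snd) (sym (⟨⟩≡⟪⟫ a b)) (sym (π₂-⟨⟩ a b)) (e-snd a b))

  eval-prec : ∀ {f g} (F : ℕ → ℕ) (G : ℕ → ℕ → ℕ → ℕ) →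
              (∀ x → Eval X f x (F x)) → (∀ x n k → Eval X g ⟪ x , ⟪ n , k ⟫ ⟫ (G x n k)) →
              ∀ x n → Eval X (prec f g) ⟪ x , n ⟫ (primRec F G x n)
  eval-prec F G f↓ g↓ x zero    = e-prec0 {x = x} (f↓ x)
  eval-prec F G f↓ g↓ x (suc n) = e-precS {x = x} (eval-prec F G f↓ g↓ x n) (g↓ x n _)

  eval-pred : ∀ n → Eval X predPR n (pred n)
  eval-pred n = e-comp (e-pair (e-zer n) (e-ident n))
    (subst (Eval X _ _) (primRec-pred n) (eval-prec _ _ e-zer (λ x m k → e-comp (e-snd x _) (e-fst m k)) 0 n))
    where
    primRec-pred : ∀ n → primRec (λ _ → 0) (λ _ m _ → m) 0 n ≡ pred n
    primRec-pred zero    = refl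
    primRec-pred (suc n) = refl

primRec-ifZero : ∀ (F G : ℕ → ℕ) x v → primRec F (λ x _ _ → G x) x v ≡ ifZero v (F x) (G x)
primRec-ifZero F G x zero    = refl
primRec-ifZero F G x (suc v) = refl

primRec-∸ : ∀ a b → primRec (λ a → a) (λ _ _ k → pred k) a b ≡ a ∸ b
primRec-∸ a zero    = refl
primRec-∸ a (suc b) = trans (cong pred (primRec-∸ a b)) (pred[m∸n]≡m∸[1+n] a b)

primRec-fold : ∀ (F f : ℕ → ℕ) x n → primRec F (λ _ _ k → f k) x n ≡ fold (F x) f n
primRec-fold F f x zero    = refl
primRec-fold F f x (suc n) = cong f (primRec-fold F f x n)

compile-correct : ∀ {X} t x → Eval X (compile t) x (⟦ t ⟧ X x)
compile-correct argᵉ x           = e-ident x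
compile-correct (litᵉ zero) x    = e-zer x
compile-correct (litᵉ (suc n)) x = e-comp (compile-correct (litᵉ n) x) (e-succ n)
compile-correct (sucᵉ t) x       = e-comp (compile-correct t x) (e-succ _)
compile-correct (π₁ᵉ t) x        = e-comp (compile-correct t x) (eval-π₁ _)
compile-correct (π₂ᵉ t) x        = e-comp (compile-correct t x) (eval-π₂ _)
compile-correct ⟨ t , u ⟩ᵉ x     = eval-⟨⟩ (e-pair (compile-correct t x) (compile-correct u x))
compile-correct (t ∘ᵉ u) x       = e-comp (compile-correct u x) (compile-correct t _)
compile-correct {X} (ifZeroᵉ t u v) x =
  e-comp (e-pair (e-ident x) (compile-correct t x))
    (subst (Eval X _ _) (primRec-ifZero (⟦ u ⟧ X) (⟦ v ⟧ X) x (⟦ t ⟧ X x))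
      (eval-prec _ _ (compile-correct u) (λ x n k → e-comp (e-fst x ⟪ n , k ⟫) (compile-correct v x)) x _))
compile-correct {X} (t ∸ᵉ u) x =
  e-comp (e-pair (compile-correct t x) (compile-correct u x))
    (subst (Eval X _ _) (primRec-∸ (⟦ t ⟧ X x) (⟦ u ⟧ X x))
      (eval-prec _ _ e-ident (λ a n k → e-comp (e-comp (e-snd a ⟪ n , k ⟫) (e-snd n k)) (eval-pred k))
        (⟦ t ⟧ X x) (⟦ u ⟧ X x)))
compile-correct {X} (foldᵉ t u v) x =
  e-comp (e-pair (e-ident x) (compile-correct v x))
    (subst (Eval X _ _) (primRec-fold (⟦ t ⟧ X) (⟦ u ⟧ X) x (⟦ v ⟧ X x))
      (eval-prec _ _ (compile-correct t)
        (λ y n k → e-comp (e-comp (e-snd y ⟪ n , k ⟫) (e-snd n k)) (compile-correct u k)) x _))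
compile-correct (oracleᵉ t) x    = e-comp (compile-correct t x) (e-orc _)

data Tree : Set where
  leaf : ℕ → Tree
  node : Tree → Tree → Tree

⌊_⌋ : Tree → ℕ
⌊ leaf n   ⌋ = n
⌊ node s t ⌋ = ⟨ ⌊ s ⌋ , ⌊ t ⌋ ⟩

fstᵀ sndᵀ : Tree → Tree
fstᵀ (leaf n)   = leaf (π₁ n)
fstᵀ (node s _) = s
sndᵀ (leaf n)   = leaf (π₂ n)
sndᵀ (node _ t) = t

⟦_⟧ᵀ : Expr → (ℕ → ℕ) → Tree → Tree
⟦ argᵉ            ⟧ᵀ X v = v
⟦ litᵉ n          ⟧ᵀ X v = leaf n
⟦ sucᵉ t          ⟧ᵀ X v = leaf (suc ⌊ ⟦ t ⟧ᵀ X v ⌋)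
⟦ π₁ᵉ t           ⟧ᵀ X v = fstᵀ (⟦ t ⟧ᵀ X v)
⟦ π₂ᵉ t           ⟧ᵀ X v = sndᵀ (⟦ t ⟧ᵀ X v)
⟦ ⟨ t , u ⟩ᵉ      ⟧ᵀ X v = node (⟦ t ⟧ᵀ X v) (⟦ u ⟧ᵀ X v)
⟦ t ∘ᵉ u          ⟧ᵀ X v = ⟦ t ⟧ᵀ X (⟦ u ⟧ᵀ X v)
⟦ ifZeroᵉ t u w   ⟧ᵀ X v = ifZero ⌊ ⟦ t ⟧ᵀ X v ⌋ (⟦ u ⟧ᵀ X v) (⟦ w ⟧ᵀ X v)
⟦ t ∸ᵉ u          ⟧ᵀ X v = leaf (⌊ ⟦ t ⟧ᵀ X v ⌋ ∸ ⌊ ⟦ u ⟧ᵀ X v ⌋)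
⟦ foldᵉ t u w     ⟧ᵀ X v = fold (⟦ t ⟧ᵀ X v) (⟦ u ⟧ᵀ X) ⌊ ⟦ w ⟧ᵀ X v ⌋
⟦ oracleᵉ t       ⟧ᵀ X v = leaf (X ⌊ ⟦ t ⟧ᵀ X v ⌋)

⌊fstᵀ⌋ : ∀ v → ⌊ fstᵀ v ⌋ ≡ π₁ ⌊ v ⌋
⌊fstᵀ⌋ (leaf n)   = refl
⌊fstᵀ⌋ (node s t) = sym (π₁-⟨⟩ ⌊ s ⌋ ⌊ t ⌋)

⌊sndᵀ⌋ : ∀ v → ⌊ sndᵀ v ⌋ ≡ π₂ ⌊ v ⌋
⌊sndᵀ⌋ (leaf n)   = refl
⌊sndᵀ⌋ (node s t) = sym (π₂-⟨⟩ ⌊ s ⌋ ⌊ t ⌋)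

ifZero-map : ∀ {A B : Set} (f : A → B) n a b → f (ifZero n a b) ≡ ifZero n (f a) (f b)
ifZero-map f zero    a b = refl
ifZero-map f (suc n) a b = refl

-- On explicitly built trees every projection computes, so by ⟦⟧-⌊⌋ each transition of the
-- machine below holds by refl.
⟦⟧-⌊⌋ : ∀ {X} t v → ⟦ t ⟧ X ⌊ v ⌋ ≡ ⌊ ⟦ t ⟧ᵀ X v ⌋
⟦⟧-⌊⌋ argᵉ v = refl
⟦⟧-⌊⌋ (litᵉ n) v = refl
⟦⟧-⌊⌋ (sucᵉ t) v = cong suc (⟦⟧-⌊⌋ t v)
⟦⟧-⌊⌋ (π₁ᵉ t) v = trans (cong π₁ (⟦⟧-⌊⌋ t v)) (sym (⌊fstᵀ⌋ (⟦ t ⟧ᵀ _ v)))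
⟦⟧-⌊⌋ (π₂ᵉ t) v = trans (cong π₂ (⟦⟧-⌊⌋ t v)) (sym (⌊sndᵀ⌋ (⟦ t ⟧ᵀ _ v)))
⟦⟧-⌊⌋ ⟨ t , u ⟩ᵉ v = cong₂ ⟨_,_⟩ (⟦⟧-⌊⌋ t v) (⟦⟧-⌊⌋ u v)
⟦⟧-⌊⌋ (t ∘ᵉ u) v = trans (cong (⟦ t ⟧ _) (⟦⟧-⌊⌋ u v)) (⟦⟧-⌊⌋ t (⟦ u ⟧ᵀ _ v))
⟦⟧-⌊⌋ {X} (ifZeroᵉ t u w) v =
  trans (cong₂ (λ n a → ifZero n a (⟦ w ⟧ X ⌊ v ⌋)) (⟦⟧-⌊⌋ t v) (⟦⟧-⌊⌋ u v))
    (trans (cong (ifZero ⌊ ⟦ t ⟧ᵀ X v ⌋ ⌊ ⟦ u ⟧ᵀ X v ⌋) (⟦⟧-⌊⌋ w v))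
      (sym (ifZero-map ⌊_⌋ ⌊ ⟦ t ⟧ᵀ X v ⌋ (⟦ u ⟧ᵀ X v) (⟦ w ⟧ᵀ X v))))
⟦⟧-⌊⌋ (t ∸ᵉ u) v = cong₂ _∸_ (⟦⟧-⌊⌋ t v) (⟦⟧-⌊⌋ u v)
⟦⟧-⌊⌋ {X} (foldᵉ t u w) v = trans (cong (fold _ (⟦ u ⟧ X)) (⟦⟧-⌊⌋ w v)) (fold-⌊⌋ ⌊ ⟦ w ⟧ᵀ X v ⌋)
  where
  fold-⌊⌋ : ∀ n → fold (⟦ t ⟧ X ⌊ v ⌋) (⟦ u ⟧ X) n ≡ ⌊ fold (⟦ t ⟧ᵀ X v) (⟦ u ⟧ᵀ X) n ⌋
  fold-⌊⌋ zero    = ⟦⟧-⌊⌋ t v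
  fold-⌊⌋ (suc n) = trans (cong (⟦ u ⟧ X) (fold-⌊⌋ n)) (⟦⟧-⌊⌋ u _)
⟦⟧-⌊⌋ {X} (oracleᵉ t) v = cong X (⟦⟧-⌊⌋ t v)

record Computer (X : ℕ → ℕ) (f : ℕ → ℕ) : Set where
  field
    expr     : Expr
    computes : ∀ x → ⟦ expr ⟧ X x ≡ f x

record Decider (X : ℕ → ℕ) (P : ℕ → Bool) : Set where
  field
    expr    : Expr
    decides : ∀ x → ⟦ expr ⟧ X x ≡ b2n (P x)

open Computer
open Decider

b2n-≡ᵇ : ∀ m n → ifZero (m ∸ n) (ifZero (n ∸ m) 1 0) 0 ≡ b2n (m ≡ᵇ n)
b2n-≡ᵇ zero    zero    = refl
b2n-≡ᵇ zero    (suc n) = refl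
b2n-≡ᵇ (suc m) zero    = refl
b2n-≡ᵇ (suc m) (suc n) = b2n-≡ᵇ m n

b2n-≤ᵇ : ∀ m n → ifZero (m ∸ n) 1 0 ≡ b2n (m ≤ᵇ n)
b2n-≤ᵇ zero          n       rewrite 0∸n≡0 n = refl
b2n-≤ᵇ (suc m)       zero    = refl
b2n-≤ᵇ (suc zero)    (suc n) rewrite 0∸n≡0 n = refl
b2n-≤ᵇ (suc (suc m)) (suc n) = b2n-≤ᵇ (suc m) n

module _ {X : ℕ → ℕ} where

  argᶜ : Computer X (λ x → x)
  argᶜ = record { expr = argᵉ ; computes = λ _ → refl }

  litᶜ : ∀ n → Computer X (λ _ → n)
  litᶜ n = record { expr = litᵉ n ; computes = λ _ → refl }

  π₁ᶜ : ∀ {f} → Computer X f → Computer X (λ x → π₁ (f x))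
  π₁ᶜ c = record { expr = π₁ᵉ (expr c) ; computes = λ x → cong π₁ (computes c x) }

  π₂ᶜ : ∀ {f} → Computer X f → Computer X (λ x → π₂ (f x))
  π₂ᶜ c = record { expr = π₂ᵉ (expr c) ; computes = λ x → cong π₂ (computes c x) }

  sucᶜ : ∀ {f} → Computer X f → Computer X (λ x → suc (f x))
  sucᶜ c = record { expr = sucᵉ (expr c) ; computes = λ x → cong suc (computes c x) }

  oracleᶜ : ∀ {f} → Computer X f → Computer X (λ x → X (f x))
  oracleᶜ c = record { expr = oracleᵉ (expr c) ; computes = λ x → cong X (computes c x) }

  _∸ᶜ_ : ∀ {f g} → Computer X f → Computer X g → Computer X (λ x → f x ∸ g x)
  c ∸ᶜ d = record
    { expr = expr c ∸ᵉ expr d ; computes = λ x → cong₂ _∸_ (computes c x) (computes d x) }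

  ⟨_,_⟩ᶜ : ∀ {f g} → Computer X f → Computer X g → Computer X (λ x → ⟨ f x , g x ⟩)
  ⟨ c , d ⟩ᶜ = record
    { expr = ⟨ expr c , expr d ⟩ᵉ ; computes = λ x → cong₂ ⟨_,_⟩ (computes c x) (computes d x) }

  _==ᵈ_ : ∀ {f g} → Computer X f → Computer X g → Decider X (λ x → f x ≡ᵇ g x)
  _==ᵈ_ {f} {g} c d = record
    { expr    = ifZeroᵉ (expr c ∸ᵉ expr d) (ifZeroᵉ (expr d ∸ᵉ expr c) (litᵉ 1) (litᵉ 0)) (litᵉ 0)
    ; decides = λ x → subst₂ (λ m n → ifZero (m ∸ n) (ifZero (n ∸ m) 1 0) 0 ≡ b2n (f x ≡ᵇ g x))
                        (sym (computes c x)) (sym (computes d x)) (b2n-≡ᵇ (f x) (g x)) }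

  _≤ᵈ_ : ∀ {f g} → Computer X f → Computer X g → Decider X (λ x → f x ≤ᵇ g x)
  _≤ᵈ_ {f} {g} c d = record
    { expr    = ifZeroᵉ (expr c ∸ᵉ expr d) (litᵉ 1) (litᵉ 0)
    ; decides = λ x → subst₂ (λ m n → ifZero (m ∸ n) 1 0 ≡ b2n (f x ≤ᵇ g x))
                        (sym (computes c x)) (sym (computes d x)) (b2n-≤ᵇ (f x) (g x)) }

  _∧ᵈ_ : ∀ {P Q} → Decider X P → Decider X Q → Decider X (λ x → P x ∧ Q x)
  _∧ᵈ_ {P} {Q} c d = record
    { expr = ifZeroᵉ (expr c) (litᵉ 0) (expr d)
    ; decides = λ x → trans (cong₂ (λ m n → ifZero m 0 n) (decides c x) (decides d x)) (b2n-∧ (P x) (Q x)) }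
    where
    b2n-∧ : ∀ p q → ifZero (b2n p) 0 (b2n q) ≡ b2n (p ∧ q)
    b2n-∧ true  q = refl
    b2n-∧ false q = refl

  _∨ᵈ_ : ∀ {P Q} → Decider X P → Decider X Q → Decider X (λ x → P x ∨ Q x)
  _∨ᵈ_ {P} {Q} c d = record
    { expr = ifZeroᵉ (expr c) (expr d) (litᵉ 1)
    ; decides = λ x → trans (cong₂ (λ m n → ifZero m n 1) (decides c x) (decides d x)) (b2n-∨ (P x) (Q x)) }
    where
    b2n-∨ : ∀ p q → ifZero (b2n p) (b2n q) 1 ≡ b2n (p ∨ q)
    b2n-∨ true  q = refl
    b2n-∨ false q = refl

  notᵈ : ∀ {P} → Decider X P → Decider X (λ x → not (P x))
  notᵈ {P} c = record
    { expr = ifZeroᵉ (expr c) (litᵉ 1) (litᵉ 0)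
    ; decides = λ x → trans (cong (λ m → ifZero m 1 0) (decides c x)) (b2n-not (P x)) }
    where
    b2n-not : ∀ p → ifZero (b2n p) 1 0 ≡ b2n (not p)
    b2n-not true  = refl
    b2n-not false = refl

  _∘ᵈ_ : ∀ {P g} → Decider X P → Computer X g → Decider X (λ x → P (g x))
  c ∘ᵈ d = record
    { expr = expr c ∘ᵉ expr d ; decides = λ x → trans (cong (⟦ expr c ⟧ X) (computes d x)) (decides c _) }

  apply₂ᵈ : ∀ {P : ℕ → ℕ → Bool} {f g} →
            Decider X (λ x → P (π₁ x) (π₂ x)) → Computer X f → Computer X g →
            Decider X (λ x → P (f x) (g x))
  apply₂ᵈ {P} c d e = record
    { expr    = expr (c ∘ᵈ ⟨ d , e ⟩ᶜ)
    ; decides = λ x → trans (decides (c ∘ᵈ ⟨ d , e ⟩ᶜ) x)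
                        (cong₂ (λ a b → b2n (P a b)) (π₁-⟨⟩ _ _) (π₂-⟨⟩ _ _)) }

decider-program : ∀ {X P} → Decider X P → Σ PR λ c → ∀ n → Eval X c n (b2n (P n))
decider-program d = compile (expr d) , λ n → subst (Eval _ _ n) (decides d n) (compile-correct (expr d) n)

encode : PR → ℕ
encode zer        = ⟨ 0 , 0 ⟩
encode succ       = ⟨ 1 , 0 ⟩
encode ident      = ⟨ 2 , 0 ⟩
encode fst        = ⟨ 3 , 0 ⟩
encode snd        = ⟨ 4 , 0 ⟩
encode orc        = ⟨ 5 , 0 ⟩
encode (comp f g) = ⟨ 6 , ⟨ encode f , encode g ⟩ ⟩
encode (pair f g) = ⟨ 7 , ⟨ encode f , encode g ⟩ ⟩
encode (prec f g) = ⟨ 8 , ⟨ encode f , encode g ⟩ ⟩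
encode (mu f)     = ⟨ 9 , encode f ⟩

encode≡enc : ∀ c → encode c ≡ enc c
encode≡enc zer        = ⟨⟩≡⟪⟫ 0 0
encode≡enc succ       = ⟨⟩≡⟪⟫ 1 0
encode≡enc ident      = ⟨⟩≡⟪⟫ 2 0
encode≡enc fst        = ⟨⟩≡⟪⟫ 3 0
encode≡enc snd        = ⟨⟩≡⟪⟫ 4 0
encode≡enc orc        = ⟨⟩≡⟪⟫ 5 0
encode≡enc (comp f g) = trans (⟨⟩²≡⟪⟫² 6 _ _) (cong₂ (λ a b → ⟪ 6 , ⟪ a , b ⟫ ⟫) (encode≡enc f) (encode≡enc g))
encode≡enc (pair f g) = trans (⟨⟩²≡⟪⟫² 7 _ _) (cong₂ (λ a b → ⟪ 7 , ⟪ a , b ⟫ ⟫) (encode≡enc f) (encode≡enc g))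
encode≡enc (prec f g) = trans (⟨⟩²≡⟪⟫² 8 _ _) (cong₂ (λ a b → ⟪ 8 , ⟪ a , b ⟫ ⟫) (encode≡enc f) (encode≡enc g))
encode≡enc (mu f)     = trans (⟨⟩≡⟪⟫ 9 _) (cong ⟪ 9 ,_⟫ (encode≡enc f))

-- States: ev c n K runs the program coded by c on n and hands the value to the stack K;
-- rt v K hands v to K; val e W checks that the worklist W consists of codes, then runs
-- ev e e nil.  A frame push t d K waits to continue a composition (t = 1), the left or the
-- right half of a pairing (t = 2, 3), a primitive-recursion step (t = 4) or a minimisation
-- test (t = 5); a stack with tag 0 is empty.
nil : ℕ
nil = ⟨ 0 , 0 ⟩

push : ℕ → ℕ → ℕ → ℕ
push t d K = ⟨ t , ⟨ d , K ⟩ ⟩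

cons : ℕ → ℕ → ℕ
cons x W = ⟨ 1 , ⟨ x , W ⟩ ⟩

ev : ℕ → ℕ → ℕ → ℕ
ev c n K = ⟨ 0 , ⟨ c , ⟨ n , K ⟩ ⟩ ⟩

rt : ℕ → ℕ → ℕ
rt v K = ⟨ 1 , ⟨ v , K ⟩ ⟩

val : ℕ → ℕ → ℕ
val e W = ⟨ 2 , ⟨ e , W ⟩ ⟩

caseFromᵉ : ℕ → Expr → List Expr → Expr → Expr
caseFromᵉ i t []       d = d
caseFromᵉ i t (b ∷ bs) d = ifZeroᵉ (t ∸ᵉ litᵉ i) b (caseFromᵉ (suc i) t bs d)

pushᵉ : ℕ → Expr → Expr → Expr
pushᵉ t d K = ⟨ litᵉ t , ⟨ d , K ⟩ᵉ ⟩ᵉ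

evᵉ : Expr → Expr → Expr → Expr
evᵉ c n K = ⟨ litᵉ 0 , ⟨ c , ⟨ n , K ⟩ᵉ ⟩ᵉ ⟩ᵉ

rtᵉ valᵉ consᵉ : Expr → Expr → Expr
rtᵉ v K = ⟨ litᵉ 1 , ⟨ v , K ⟩ᵉ ⟩ᵉ
valᵉ e W = ⟨ litᵉ 2 , ⟨ e , W ⟩ᵉ ⟩ᵉ
consᵉ x W = ⟨ litᵉ 1 , ⟨ x , W ⟩ᵉ ⟩ᵉ

module EvMode where
  c t a n K : Expr
  c = π₁ᵉ (π₂ᵉ argᵉ)
  t = π₁ᵉ c
  a = π₂ᵉ c
  n = π₁ᵉ (π₂ᵉ (π₂ᵉ argᵉ))
  K = π₂ᵉ (π₂ᵉ (π₂ᵉ argᵉ))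

  n−1 : Expr
  n−1 = ⟨ π₁ᵉ n , π₂ᵉ n ∸ᵉ litᵉ 1 ⟩ᵉ

  stepᵉ : Expr
  stepᵉ = caseFromᵉ 0 t
    ( rtᵉ (litᵉ 0) K
    ∷ rtᵉ (sucᵉ n) K
    ∷ rtᵉ n K
    ∷ rtᵉ (π₁ᵉ n) K
    ∷ rtᵉ (π₂ᵉ n) K
    ∷ rtᵉ (litᵉ 0) K
    ∷ evᵉ (π₂ᵉ a) n (pushᵉ 1 (π₁ᵉ a) K)
    ∷ evᵉ (π₁ᵉ a) n (pushᵉ 2 ⟨ π₂ᵉ a , n ⟩ᵉ K)
    ∷ ifZeroᵉ (π₂ᵉ n) (evᵉ (π₁ᵉ a) (π₁ᵉ n) K)
                      (evᵉ c n−1 (pushᵉ 4 ⟨ π₂ᵉ a , n−1 ⟩ᵉ K))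
    ∷ evᵉ a ⟨ n , litᵉ 0 ⟩ᵉ (pushᵉ 5 ⟨ a , ⟨ n , litᵉ 0 ⟩ᵉ ⟩ᵉ K)
    ∷ []) argᵉ

module RtMode where
  v t d K : Expr
  v = π₁ᵉ (π₂ᵉ argᵉ)
  t = π₁ᵉ (π₂ᵉ (π₂ᵉ argᵉ))
  d = π₁ᵉ (π₂ᵉ (π₂ᵉ (π₂ᵉ argᵉ)))
  K = π₂ᵉ (π₂ᵉ (π₂ᵉ (π₂ᵉ argᵉ)))

  next : Expr
  next = ⟨ π₁ᵉ (π₂ᵉ d) , sucᵉ (π₂ᵉ (π₂ᵉ d)) ⟩ᵉ

  stepᵉ : Expr
  stepᵉ = caseFromᵉ 0 t
    ( argᵉ
    ∷ evᵉ d v K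
    ∷ evᵉ (π₁ᵉ d) (π₂ᵉ d) (pushᵉ 3 v K)
    ∷ rtᵉ ⟨ d , v ⟩ᵉ K
    ∷ evᵉ (π₁ᵉ d) ⟨ π₁ᵉ (π₂ᵉ d) , ⟨ π₂ᵉ (π₂ᵉ d) , v ⟩ᵉ ⟩ᵉ K
    ∷ ifZeroᵉ v (rtᵉ (π₂ᵉ (π₂ᵉ d)) K)
                (evᵉ (π₁ᵉ d) next (pushᵉ 5 ⟨ π₁ᵉ d , next ⟩ᵉ K))
    ∷ []) argᵉ

module ValMode where
  e W x W′ : Expr
  e  = π₁ᵉ (π₂ᵉ argᵉ)
  W  = π₂ᵉ (π₂ᵉ argᵉ)
  x  = π₁ᵉ (π₂ᵉ W)
  W′ = π₂ᵉ (π₂ᵉ W)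

  basic both : Expr
  basic = ifZeroᵉ (π₂ᵉ x) (valᵉ e W′) argᵉ
  both  = valᵉ e (consᵉ (π₁ᵉ (π₂ᵉ x)) (consᵉ (π₂ᵉ (π₂ᵉ x)) W′))

  stepᵉ : Expr
  stepᵉ = ifZeroᵉ (π₁ᵉ W) (evᵉ e e ⟨ litᵉ 0 , litᵉ 0 ⟩ᵉ)
    (caseFromᵉ 0 (π₁ᵉ x)
      ( basic ∷ basic ∷ basic ∷ basic ∷ basic ∷ basic ∷ both ∷ both ∷ both
      ∷ valᵉ e (consᵉ (π₂ᵉ x) W′)
      ∷ []) argᵉ)

stepᵉ : Expr
stepᵉ = caseFromᵉ 0 (π₁ᵉ argᵉ) (EvMode.stepᵉ ∷ RtMode.stepᵉ ∷ ValMode.stepᵉ ∷ []) argᵉ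

-- Opaque, since otherwise Agda normalises whole runs of the machine when abstracting over them.
opaque
  step : ℕ → ℕ
  step = ⟦ stepᵉ ⟧ noOracle

  ⟦stepᵉ⟧≡step : ⟦ stepᵉ ⟧ noOracle ≡ step
  ⟦stepᵉ⟧≡step = refl

step-⌊⌋ : ∀ v → step ⌊ v ⌋ ≡ ⌊ ⟦ stepᵉ ⟧ᵀ noOracle v ⌋
step-⌊⌋ v = trans (cong (λ f → f ⌊ v ⌋) (sym ⟦stepᵉ⟧≡step)) (⟦⟧-⌊⌋ {noOracle} stepᵉ v)

⟨_,_⟩ᵀ : ℕ → ℕ → Tree
⟨ a , b ⟩ᵀ = node (leaf a) (leaf b)

evᵀ : Tree → Tree → ℕ → Tree
evᵀ c n K = node (leaf 0) (node c (node n (leaf K)))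

rtᵀ : ℕ → ℕ → Tree → ℕ → Tree
rtᵀ v t d K = node (leaf 1) (node (leaf v) (node (leaf t) (node d (leaf K))))

step-rt : ∀ v t d K → step (rt v (push t d K)) ≡ ⌊ ⟦ stepᵉ ⟧ᵀ noOracle (rtᵀ v t (leaf d) K) ⌋
step-rt v t d K = step-⌊⌋ (rtᵀ v t (leaf d) K)

module _ {n K : ℕ} where

  step-zer   : step (ev (encode zer) n K) ≡ rt 0 K
  step-zer   = step-⌊⌋ (evᵀ ⟨ 0 , 0 ⟩ᵀ (leaf n) K)
  step-succ  : step (ev (encode succ) n K) ≡ rt (suc n) K
  step-succ  = step-⌊⌋ (evᵀ ⟨ 1 , 0 ⟩ᵀ (leaf n) K)
  step-ident : step (ev (encode ident) n K) ≡ rt n K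
  step-ident = step-⌊⌋ (evᵀ ⟨ 2 , 0 ⟩ᵀ (leaf n) K)
  step-fst   : step (ev (encode fst) n K) ≡ rt (π₁ n) K
  step-fst   = step-⌊⌋ (evᵀ ⟨ 3 , 0 ⟩ᵀ (leaf n) K)
  step-snd   : step (ev (encode snd) n K) ≡ rt (π₂ n) K
  step-snd   = step-⌊⌋ (evᵀ ⟨ 4 , 0 ⟩ᵀ (leaf n) K)
  step-orc   : step (ev (encode orc) n K) ≡ rt 0 K
  step-orc   = step-⌊⌋ (evᵀ ⟨ 5 , 0 ⟩ᵀ (leaf n) K)

  step-comp : ∀ f g → step (ev ⟨ 6 , ⟨ f , g ⟩ ⟩ n K) ≡ ev g n (push 1 f K)
  step-comp f g = step-⌊⌋ (evᵀ (node (leaf 6) ⟨ f , g ⟩ᵀ) (leaf n) K)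

  step-pair : ∀ f g → step (ev ⟨ 7 , ⟨ f , g ⟩ ⟩ n K) ≡ ev f n (push 2 ⟨ g , n ⟩ K)
  step-pair f g = step-⌊⌋ (evᵀ (node (leaf 7) ⟨ f , g ⟩ᵀ) (leaf n) K)

  step-mu : ∀ f → step (ev ⟨ 9 , f ⟩ n K) ≡ ev f ⟨ n , 0 ⟩ (push 5 ⟨ f , ⟨ n , 0 ⟩ ⟩ K)
  step-mu f = step-⌊⌋ (evᵀ ⟨ 9 , f ⟩ᵀ (leaf n) K)

step-prec-zero : ∀ f g x K → step (ev ⟨ 8 , ⟨ f , g ⟩ ⟩ ⟨ x , 0 ⟩ K) ≡ ev f x K
step-prec-zero f g x K = step-⌊⌋ (evᵀ (node (leaf 8) ⟨ f , g ⟩ᵀ) ⟨ x , 0 ⟩ᵀ K)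

step-prec-suc : ∀ f g x t K →
  step (ev ⟨ 8 , ⟨ f , g ⟩ ⟩ ⟨ x , suc t ⟩ K)
    ≡ ev ⟨ 8 , ⟨ f , g ⟩ ⟩ ⟨ x , t ⟩ (push 4 ⟨ g , ⟨ x , t ⟩ ⟩ K)
step-prec-suc f g x t K = step-⌊⌋ (evᵀ (node (leaf 8) ⟨ f , g ⟩ᵀ) ⟨ x , suc t ⟩ᵀ K)

step-halt : ∀ v r → step (rt v ⟨ 0 , r ⟩) ≡ rt v ⟨ 0 , r ⟩
step-halt v r = step-⌊⌋ (node (leaf 1) (node (leaf v) ⟨ 0 , r ⟩ᵀ))

step-ret-comp : ∀ v f K → step (rt v (push 1 f K)) ≡ ev f v K
step-ret-comp v f K = step-rt v 1 f K

step-ret-pair₁ : ∀ a g n K → step (rt a (push 2 ⟨ g , n ⟩ K)) ≡ ev g n (push 3 a K)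
step-ret-pair₁ a g n K = step-⌊⌋ (rtᵀ a 2 ⟨ g , n ⟩ᵀ K)

step-ret-pair₂ : ∀ b a K → step (rt b (push 3 a K)) ≡ rt ⟨ a , b ⟩ K
step-ret-pair₂ b a K = step-rt b 3 a K

step-ret-prec : ∀ k g x t K →
  step (rt k (push 4 ⟨ g , ⟨ x , t ⟩ ⟩ K)) ≡ ev g ⟨ x , ⟨ t , k ⟩ ⟩ K
step-ret-prec k g x t K = step-⌊⌋ (rtᵀ k 4 (node (leaf g) ⟨ x , t ⟩ᵀ) K)

step-ret-mu-zero : ∀ f x z K → step (rt 0 (push 5 ⟨ f , ⟨ x , z ⟩ ⟩ K)) ≡ rt z K
step-ret-mu-zero f x z K = step-⌊⌋ (rtᵀ 0 5 (node (leaf f) ⟨ x , z ⟩ᵀ) K)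

step-ret-mu-suc : ∀ v f x z K →
  step (rt (suc v) (push 5 ⟨ f , ⟨ x , z ⟩ ⟩ K))
    ≡ ev f ⟨ x , suc z ⟩ (push 5 ⟨ f , ⟨ x , suc z ⟩ ⟩ K)
step-ret-mu-suc v f x z K = step-⌊⌋ (rtᵀ (suc v) 5 (node (leaf f) ⟨ x , z ⟩ᵀ) K)

valᵀ : ℕ → ℕ → Tree → ℕ → Tree
valᵀ e j x W = node (leaf 2) (node (leaf e) (node (leaf j) (node x (leaf W))))

step-val-done : ∀ e W → step (val e ⟨ 0 , W ⟩) ≡ ev e e nil
step-val-done e W = step-⌊⌋ (node (leaf 2) (node (leaf e) ⟨ 0 , W ⟩ᵀ))

IsCode : ℕ → Set
IsCode x = Σ PR λ c → encode c ≡ x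

-- Evaluates c n K quantifies over all programs coded by c and so holds vacuously for junk c;
-- this is why the machine first validates its input: the base case of prec never inspects g.
mutual
  Succeeds : PR → ℕ → ℕ → Set
  Succeeds code n K = Σ ℕ λ m → Eval noOracle code n m × Cont K m

  Evaluates : ℕ → ℕ → ℕ → Set
  Evaluates c n K = ∀ code → encode code ≡ c → Succeeds code n K

  data Cont (K v : ℕ) : Set where
    empty : π₁ K ≡ 0 → Cont K v
    frame : Frame (π₁ K) (π₁ (π₂ K)) (π₂ (π₂ K)) v → Cont K v

  Frame : ℕ → ℕ → ℕ → ℕ → Set
  Frame 1 f K v = Evaluates f v K
  Frame 2 d K v = Evaluates (π₁ d) (π₂ d) (push 3 v K)
  Frame 3 a K v = Cont K ⟨ a , v ⟩
  Frame 4 d K v = Evaluates (π₁ d) ⟨ π₁ (π₂ d) , ⟨ π₂ (π₂ d) , v ⟩ ⟩ K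
  Frame 5 d K v = MuFrame (π₁ d) (π₁ (π₂ d)) (π₂ (π₂ d)) K v
  Frame _ _ _ _ = ⊥

  MuFrame : ℕ → ℕ → ℕ → ℕ → ℕ → Set
  MuFrame f x z K v = ∀ code → encode code ≡ f → Eval noOracle code ⟨ x , z ⟩ v → MuSearch code x z K

  MuSearch : PR → ℕ → ℕ → ℕ → Set
  MuSearch code x z K = Σ ℕ λ y → z ≤ y × Eval noOracle code ⟪ x , y ⟫ 0 ×
    (∀ w → z ≤ w → w < y → Σ ℕ λ k → Eval noOracle code ⟪ x , w ⟫ (suc k)) × Cont K y

data Valid (W : ℕ) : Set where
  done : π₁ W ≡ 0 → Valid W
  next : IsCode (π₁ (π₂ W)) → Valid (π₂ (π₂ W)) → Valid W

SemAt : ℕ → ℕ → Set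
SemAt 0 r = Evaluates (π₁ r) (π₁ (π₂ r)) (π₂ (π₂ r))
SemAt 1 r = Cont (π₂ r) (π₁ r)
SemAt 2 r = Valid (π₂ r) × Evaluates (π₁ r) (π₁ r) nil
SemAt _ _ = ⊥

Sem : ℕ → Set
Sem s = SemAt (π₁ s) (π₂ s)

unpair₂ : ∀ (F : ℕ → ℕ → Set) {a b} → F (π₁ ⟨ a , b ⟩) (π₂ ⟨ a , b ⟩) ≡ F a b
unpair₂ F {a} {b} = cong₂ F (π₁-⟨⟩ a b) (π₂-⟨⟩ a b)

unpair₃ : ∀ (F : ℕ → ℕ → ℕ → Set) {a b c} →
          let abc = ⟨ a , ⟨ b , c ⟩ ⟩ in F (π₁ abc) (π₁ (π₂ abc)) (π₂ (π₂ abc)) ≡ F a b c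
unpair₃ F {a} {b} {c} rewrite π₁-⟨⟩ a ⟨ b , c ⟩ | π₂-⟨⟩ a ⟨ b , c ⟩ = unpair₂ (F a)

Sem-ev : ∀ {c n K} → Sem (ev c n K) ≡ Evaluates c n K
Sem-ev = trans (unpair₂ SemAt) (unpair₃ Evaluates)

Sem-rt : ∀ {v K} → Sem (rt v K) ≡ Cont K v
Sem-rt = trans (unpair₂ SemAt) (unpair₂ λ v K → Cont K v)

Sem-val : ∀ {e W} → Sem (val e W) ≡ (Valid W × Evaluates e e nil)
Sem-val = trans (unpair₂ SemAt) (unpair₂ λ e W → Valid W × Evaluates e e nil)

frame⁺ : ∀ {t d K v} → Frame t d K v → Cont (push t d K) v
frame⁺ = frame ∘ subst id (sym (unpair₃ λ t d K → Frame t d K _))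

frame⁻ : ∀ {t d K v} → Cont (push (suc t) d K) v → Frame (suc t) d K v
frame⁻ {t} {d} {K} (empty eq) = ⊥-elim (1+n≢0 (trans (sym (π₁-⟨⟩ (suc t) ⟨ d , K ⟩)) eq))
frame⁻             (frame fr) = subst id (unpair₃ λ t d K → Frame t d K _) fr

input-⟪⟫ : ∀ {X c a b m} → Eval X c ⟨ a , b ⟩ m → Eval X c ⟪ a , b ⟫ m
input-⟪⟫ {a = a} {b} = subst (λ n → Eval _ _ n _) (⟨⟩≡⟪⟫ a b)

input-⟨⟩ : ∀ {X c a b m} → Eval X c ⟪ a , b ⟫ m → Eval X c ⟨ a , b ⟩ m
input-⟨⟩ {a = a} {b} = subst (λ n → Eval _ _ n _) (sym (⟨⟩≡⟪⟫ a b))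

output-⟨⟩ : ∀ {X c n a b} → Eval X c n ⟪ a , b ⟫ → Eval X c n ⟨ a , b ⟩
output-⟨⟩ {a = a} {b} = subst (Eval _ _ _) (sym (⟨⟩≡⟪⟫ a b))

via : ∀ {s s′} → step s ≡ s′ → Sem (step s) → Sem s′
via = subst Sem

mu-start : ∀ {f x z K} → Cont K z → MuFrame f x z K 0
mu-start {z = z} C code _ E = z , ≤-refl , input-⟪⟫ E , (λ w z≤w w<z → ⊥-elim (<⇒≱ w<z z≤w)) , C

mu-continue : ∀ {f x z K v} →
  Evaluates f ⟨ x , suc z ⟩ (push 5 ⟨ f , ⟨ x , suc z ⟩ ⟩ K) → MuFrame f x z K (suc v)
mu-continue {f} {x} {z} {K} {v} h code refl E with h code refl
... | v′ , E′ , C′ with subst id (unpair₃ λ f x z → MuFrame f x z K v′) (frame⁻ C′) code refl E′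
... | y , z<y , E₀ , below , C = y , <⇒≤ z<y , E₀ , below′ , C
  where
  below′ : ∀ w → z ≤ w → w < y → Σ ℕ λ k → Eval noOracle code ⟪ x , w ⟫ (suc k)
  below′ w z≤w w<y with m≤n⇒m<n∨m≡n z≤w
  ... | inj₁ z<w  = below w z<w w<y
  ... | inj₂ refl = v , input-⟪⟫ E

back-ev : ∀ code {n K} → Sem (step (ev (encode code) n K)) → Succeeds code n K
back-ev zer   {n} h = 0 , e-zer n , subst id Sem-rt (via step-zer h)
back-ev succ  {n} h = suc n , e-succ n , subst id Sem-rt (via step-succ h)
back-ev ident {n} h = n , e-ident n , subst id Sem-rt (via step-ident h)
back-ev fst   {n} h = π₁ n , eval-π₁ n , subst id Sem-rt (via step-fst h)
back-ev snd   {n} h = π₂ n , eval-π₂ n , subst id Sem-rt (via step-snd h)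
back-ev orc   {n} h = 0 , e-orc n , subst id Sem-rt (via step-orc h)
back-ev (comp f g) h with subst id Sem-ev (via (step-comp _ _) h) g refl
... | k , E-g , C-g with frame⁻ C-g f refl
... | m , E-f , C = m , e-comp E-g E-f , C
back-ev (pair f g) {n} h with subst id Sem-ev (via (step-pair _ _) h) f refl
... | a , E-f , C-f with subst id (unpair₂ λ g n → Evaluates g n _) (frame⁻ C-f) g refl
... | b , E-g , C-g = ⟨ a , b ⟩ , output-⟨⟩ (e-pair E-f E-g) , frame⁻ C-g
back-ev (prec f g) {n} {K} =
  ⟨⟩-elim (λ n → Sem (step (ev (encode (prec f g)) n K)) → Succeeds (prec f g) n K) back-prec n
  where
  back-prec : ∀ x t → Sem (step (ev (encode (prec f g)) ⟨ x , t ⟩ K)) → Succeeds (prec f g) ⟨ x , t ⟩ K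
  back-prec x zero h with subst id Sem-ev (via (step-prec-zero _ _ x K) h) f refl
  ... | m , E-f , C = m , input-⟨⟩ (e-prec0 {x = x} E-f) , C
  back-prec x (suc t) h with subst id Sem-ev (via (step-prec-suc _ _ x t K) h) (prec f g) refl
  ... | k , E-t , C-t with subst id (unpair₃ λ g x t → Evaluates g ⟨ x , ⟨ t , k ⟩ ⟩ K) (frame⁻ C-t) g refl
  ... | m , E-g , C =
    m , input-⟨⟩ (e-precS {x = x} (input-⟪⟫ E-t) (subst (λ n → Eval _ _ n m) (⟨⟩²≡⟪⟫² x t k) E-g)) , C
back-ev (mu f) {n} {K} h with subst id Sem-ev (via (step-mu _) h) f refl
... | v , E-f , C-f with subst id (unpair₃ λ f x z → MuFrame f x z K v) (frame⁻ C-f) f refl E-f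
... | y , _ , E-y , below , C = y , e-mu E-y (λ w w<y → below w z≤n w<y) , C

back-rt : ∀ v K → Sem (step (rt v K)) → Cont K v
back-rt v = ⟨⟩-elim (λ K → Sem (step (rt v K)) → Cont K v) λ t → ⟨⟩-elim _ (back-frame v t)
  where
  back-frame : ∀ v t d K → Sem (step (rt v (push t d K))) → Cont (push t d K) v
  back-frame v 0 d K _ = empty (π₁-⟨⟩ 0 _)
  back-frame v 1 d K h = frame⁺ (subst id Sem-ev (via (step-rt v 1 d K) h))
  back-frame v 2 d K h = frame⁺ (subst id Sem-ev (via (step-rt v 2 d K) h))
  back-frame v 3 d K h = frame⁺ (subst id Sem-rt (via (step-rt v 3 d K) h))
  back-frame v 4 d K h = frame⁺ (subst id Sem-ev (via (step-rt v 4 d K) h))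
  back-frame zero 5 d K h = frame⁺ (mu-start (subst id Sem-rt (via (step-rt 0 5 d K) h)))
  back-frame (suc v) 5 d K h = frame⁺ (mu-continue (subst id Sem-ev (via (step-rt (suc v) 5 d K) h)))
  back-frame v (suc (suc (suc (suc (suc (suc t)))))) d K h = subst id Sem-rt (via (step-rt v (6 + t) d K) h)

Valid-cons⁺ : ∀ {j x W} → IsCode x → Valid W → Valid ⟨ j , ⟨ x , W ⟩ ⟩
Valid-cons⁺ x-ok W-ok = next (subst id (sym (unpair₃ λ _ x _ → IsCode x)) x-ok)
                             (subst id (sym (unpair₃ λ _ _ W → Valid W)) W-ok)

Valid-cons⁻ : ∀ {j x W} → Valid ⟨ suc j , ⟨ x , W ⟩ ⟩ → IsCode x × Valid W
Valid-cons⁻ {j} (done eq)         = ⊥-elim (1+n≢0 (trans (sym (π₁-⟨⟩ (suc j) _)) eq))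
Valid-cons⁻     (next x-ok W-ok) =
  subst id (unpair₃ λ _ x _ → IsCode x) x-ok , subst id (unpair₃ λ _ _ W → Valid W) W-ok

binary-code : ∀ {a} (op : PR → PR → PR) t →
              (∀ f g → encode (op f g) ≡ ⟨ t , ⟨ encode f , encode g ⟩ ⟩) →
              IsCode (π₁ a) → IsCode (π₂ a) → IsCode ⟨ t , a ⟩
binary-code {a} op t encode-op (f , f≡) (g , g≡) =
  op f g , trans (encode-op f g) (cong ⟨ t ,_⟩ (trans (cong₂ ⟨_,_⟩ f≡ g≡) (⟨π₁,π₂⟩ a)))

step-val : ∀ e j t a W →
  step (val e ⟨ suc j , ⟨ ⟨ t , a ⟩ , W ⟩ ⟩) ≡ ⌊ ⟦ stepᵉ ⟧ᵀ noOracle (valᵀ e (suc j) ⟨ t , a ⟩ᵀ W) ⌋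
step-val e j t a W = step-⌊⌋ (valᵀ e (suc j) ⟨ t , a ⟩ᵀ W)

back-val : ∀ e W → Sem (step (val e W)) → Valid W × Evaluates e e nil
back-val e = ⟨⟩-elim (λ W → Sem (step (val e W)) → Goal W) back-list
  where
  Goal : ℕ → Set
  Goal W = Valid W × Evaluates e e nil

  Back : ℕ → Set
  Back W = Sem (step (val e W)) → Goal W

  stuck : ∀ {W} → Sem (val e W) → Goal W
  stuck = subst id Sem-val

  basic : ∀ code {j W} → Sem (val e W) → Goal ⟨ suc j , ⟨ encode code , W ⟩ ⟩
  basic code h with subst id Sem-val h
  ... | W-ok , E = Valid-cons⁺ (code , refl) W-ok , E

  binary : ∀ op t {j a W} → (∀ f g → encode (op f g) ≡ ⟨ t , ⟨ encode f , encode g ⟩ ⟩) →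
           Sem (val e (cons (π₁ a) (cons (π₂ a) W))) → Goal ⟨ suc j , ⟨ ⟨ t , a ⟩ , W ⟩ ⟩
  binary op t encode-op h with subst id Sem-val h
  ... | V , E with Valid-cons⁻ V
  ... | f-ok , V′ with Valid-cons⁻ V′
  ... | g-ok , W-ok = Valid-cons⁺ (binary-code op t encode-op f-ok g-ok) W-ok , E

  unary : ∀ {j a W} → Sem (val e (cons a W)) → Goal ⟨ suc j , ⟨ ⟨ 9 , a ⟩ , W ⟩ ⟩
  unary h with subst id Sem-val h
  ... | V , E with Valid-cons⁻ V
  ... | (f , f≡) , W-ok = Valid-cons⁺ (mu f , cong ⟨ 9 ,_⟩ f≡) W-ok , E

  back-head : ∀ j t a W → Back ⟨ suc j , ⟨ ⟨ t , a ⟩ , W ⟩ ⟩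
  back-head j 0 zero    W h = basic zer   (via (step-val e j 0 0 W) h)
  back-head j 1 zero    W h = basic succ  (via (step-val e j 1 0 W) h)
  back-head j 2 zero    W h = basic ident (via (step-val e j 2 0 W) h)
  back-head j 3 zero    W h = basic fst   (via (step-val e j 3 0 W) h)
  back-head j 4 zero    W h = basic snd   (via (step-val e j 4 0 W) h)
  back-head j 5 zero    W h = basic orc   (via (step-val e j 5 0 W) h)
  back-head j 0 (suc a) W h = stuck (via (step-val e j 0 (suc a) W) h)
  back-head j 1 (suc a) W h = stuck (via (step-val e j 1 (suc a) W) h)
  back-head j 2 (suc a) W h = stuck (via (step-val e j 2 (suc a) W) h)
  back-head j 3 (suc a) W h = stuck (via (step-val e j 3 (suc a) W) h)
  back-head j 4 (suc a) W h = stuck (via (step-val e j 4 (suc a) W) h)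
  back-head j 5 (suc a) W h = stuck (via (step-val e j 5 (suc a) W) h)
  back-head j 6 a W h = binary comp 6 (λ _ _ → refl) (via (step-val e j 6 a W) h)
  back-head j 7 a W h = binary pair 7 (λ _ _ → refl) (via (step-val e j 7 a W) h)
  back-head j 8 a W h = binary prec 8 (λ _ _ → refl) (via (step-val e j 8 a W) h)
  back-head j 9 a W h = unary (via (step-val e j 9 a W) h)
  back-head j (suc (suc (suc (suc (suc (suc (suc (suc (suc (suc t)))))))))) a W h =
    stuck (via (step-val e j (10 + t) a W) h)

  back-list : ∀ j r → Back ⟨ j , r ⟩
  back-list zero r h = done (π₁-⟨⟩ 0 r) , subst id Sem-ev (via (step-val-done e r) h)
  back-list (suc j) = ⟨⟩-elim (λ r → Back ⟨ suc j , r ⟩) λ x W →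
    ⟨⟩-elim (λ x → Back ⟨ suc j , ⟨ x , W ⟩ ⟩) (λ t a → back-head j t a W) x

back-evaluates : ∀ c n K → Sem (step (ev c n K)) → Evaluates c n K
back-evaluates .(encode code) n K h code refl = back-ev code h

step-idle : ∀ m r → step ⟨ 3 + m , r ⟩ ≡ ⟨ 3 + m , r ⟩
step-idle m r = step-⌊⌋ ⟨ 3 + m , r ⟩ᵀ

back : ∀ s → Sem (step s) → Sem s
back = ⟨⟩-elim Back back-mode
  where
  Back : ℕ → Set
  Back s = Sem (step s) → Sem s

  back-mode : ∀ m r → Back ⟨ m , r ⟩
  back-mode 0 = ⟨⟩-elim (λ r → Back ⟨ 0 , r ⟩) λ c →
    ⟨⟩-elim (λ r → Back ⟨ 0 , ⟨ c , r ⟩ ⟩) λ n K h → subst id (sym Sem-ev) (back-evaluates c n K h)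
  back-mode 1 = ⟨⟩-elim (λ r → Back ⟨ 1 , r ⟩) λ v K h → subst id (sym Sem-rt) (back-rt v K h)
  back-mode 2 = ⟨⟩-elim (λ r → Back ⟨ 2 , r ⟩) λ e W h → subst id (sym Sem-val) (back-val e W h)
  back-mode (suc (suc (suc m))) r h = via (step-idle m r) h

back-fold : ∀ j s → Sem (fold s step j) → Sem s
back-fold zero    s h = h
back-fold (suc j) s h = back-fold j s (back (fold s step j) h)

final? : ℕ → Bool
final? s = (π₁ s ≡ᵇ 1) ∧ (π₁ (π₂ (π₂ s)) ≡ᵇ 0)

final⇒halted : ∀ {s} → T (final? s) → Σ ℕ λ v → Σ ℕ λ r → s ≡ rt v ⟨ 0 , r ⟩
final⇒halted {s} fin with Equivalence.to T-∧ fin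
... | mode≡1 , top≡0 = v , π₂ K , (begin
  s                  ≡⟨ sym (⟨π₁,π₂⟩ s) ⟩
  ⟨ π₁ s , π₂ s ⟩    ≡⟨ cong₂ ⟨_,_⟩ (≡ᵇ⇒≡ _ 1 mode≡1) (sym (⟨π₁,π₂⟩ (π₂ s))) ⟩
  rt v K             ≡⟨ cong (rt v) (sym (⟨π₁,π₂⟩ K)) ⟩
  rt v ⟨ π₁ K , π₂ K ⟩ ≡⟨ cong (λ t → rt v ⟨ t , π₂ K ⟩) (≡ᵇ⇒≡ _ 0 top≡0) ⟩
  rt v ⟨ 0 , π₂ K ⟩  ∎)
  where
  open ≡-Reasoning
  v K : ℕ
  v = π₁ (π₂ s)
  K = π₂ (π₂ s)

final-Sem : ∀ {s} → T (final? s) → Sem s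
final-Sem fin with final⇒halted fin
... | v , r , refl = subst id (sym Sem-rt) (empty (π₁-⟨⟩ 0 r))

final-fixed : ∀ {s} → T (final? s) → step s ≡ s
final-fixed fin with final⇒halted fin
... | v , r , refl = step-halt v r

final-rt : ∀ v r → T (final? (rt v ⟨ 0 , r ⟩))
final-rt v r rewrite π₁-⟨⟩ 1 ⟨ v , ⟨ 0 , r ⟩ ⟩ | π₂-⟨⟩ 1 ⟨ v , ⟨ 0 , r ⟩ ⟩ | π₂-⟨⟩ v ⟨ 0 , r ⟩ | π₁-⟨⟩ 0 r
  = _

start : ℕ → ℕ
start e = val e (cons e nil)

haltsWithin? : ℕ → ℕ → Bool
haltsWithin? e j = final? (fold (start e) step j)

haltsWithin-sound : ∀ {e j} → T (haltsWithin? e j) → HaltingSet e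
haltsWithin-sound {e} {j} fin with subst id Sem-val (back-fold j (start e) (final-Sem fin))
... | valid , evaluates with Valid-cons⁻ valid
... | (code , code≡e) , _ with evaluates code code≡e
... | m , E , _ = code , trans (sym (encode≡enc code)) code≡e , m , E

Reach : ℕ → ℕ → Set
Reach = Star (λ s s′ → step s ≡ s′)

reach-input-⟪⟫ : ∀ {c a b K t} → Reach (ev c ⟨ a , b ⟩ K) t → Reach (ev c ⟪ a , b ⟫ K) t
reach-input-⟪⟫ {c} {a} {b} {K} {t} = subst (λ n → Reach (ev c n K) t) (⟨⟩≡⟪⟫ a b)

reach-input-⟨⟩ : ∀ {c a b K t} → Reach (ev c ⟪ a , b ⟫ K) t → Reach (ev c ⟨ a , b ⟩ K) t
reach-input-⟨⟩ {c} {a} {b} {K} {t} = subst (λ n → Reach (ev c n K) t) (sym (⟨⟩≡⟪⟫ a b))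

reach-ev : ∀ {code n m} → Eval noOracle code n m → ∀ K → Reach (ev (encode code) n K) (rt m K)
reach-ev (e-zer n)   K = step-zer ◅ ε
reach-ev (e-succ n)  K = step-succ ◅ ε
reach-ev (e-ident n) K = step-ident ◅ ε
reach-ev (e-fst a b) K = trans step-fst (cong (λ v → rt v K) (π₁-⟪⟫ a b)) ◅ ε
reach-ev (e-snd a b) K = trans step-snd (cong (λ v → rt v K) (π₂-⟪⟫ a b)) ◅ ε
reach-ev (e-orc n)   K = step-orc ◅ ε
reach-ev (e-comp {f} {g} {n} {k} E-g E-f) K =
  step-comp _ _ ◅ reach-ev E-g (push 1 (encode f) K) ◅◅ step-ret-comp k (encode f) K ◅ reach-ev E-f K
reach-ev (e-pair {f} {g} {n} {a} {b} E-f E-g) K =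
  step-pair _ _ ◅ reach-ev E-f (push 2 ⟨ encode g , n ⟩ K) ◅◅ step-ret-pair₁ a (encode g) n K ◅
  reach-ev E-g (push 3 a K) ◅◅
  trans (step-ret-pair₂ b a K) (cong (λ v → rt v K) (⟨⟩≡⟪⟫ a b)) ◅ ε
reach-ev (e-prec0 {f} {g} {x} E-f) K = reach-input-⟪⟫ (step-prec-zero _ _ x K ◅ reach-ev E-f K)
reach-ev (e-precS {f} {g} {x} {t} {k} {m} E-t E-g) K = reach-input-⟪⟫
  (step-prec-suc _ _ x t K ◅ reach-input-⟨⟩ (reach-ev E-t (push 4 ⟨ encode g , ⟨ x , t ⟩ ⟩ K)) ◅◅
   step-ret-prec k (encode g) x t K ◅
   subst (λ n → Reach (ev (encode g) n K) (rt m K)) (sym (⟨⟩²≡⟪⟫² x t k)) (reach-ev E-g K))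
reach-ev (e-mu {f} {x} {y} E-y below) K = step-mu _ ◅ search y 0 (+-identityʳ y)
  where
  search : ∀ d z → d + z ≡ y →
           Reach (ev (encode f) ⟨ x , z ⟩ (push 5 ⟨ encode f , ⟨ x , z ⟩ ⟩ K)) (rt y K)
  search zero    z refl = reach-input-⟨⟩ (reach-ev E-y _) ◅◅ step-ret-mu-zero _ x z K ◅ ε
  search (suc d) z d+z≡y =
    reach-input-⟨⟩ (reach-ev (proj₂ (below z z<y)) _) ◅◅
    step-ret-mu-suc _ _ x z K ◅ search d (suc z) (trans (+-suc d z) d+z≡y)
    where
    z<y : z < y
    z<y = subst (z <_) d+z≡y (s≤s (m≤n+m z d))

reach-val : ∀ code e W → Reach (val e (cons (encode code) W)) (val e W)
reach-val zer   e W = step-⌊⌋ (valᵀ e 1 ⟨ 0 , 0 ⟩ᵀ W) ◅ ε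
reach-val succ  e W = step-⌊⌋ (valᵀ e 1 ⟨ 1 , 0 ⟩ᵀ W) ◅ ε
reach-val ident e W = step-⌊⌋ (valᵀ e 1 ⟨ 2 , 0 ⟩ᵀ W) ◅ ε
reach-val fst   e W = step-⌊⌋ (valᵀ e 1 ⟨ 3 , 0 ⟩ᵀ W) ◅ ε
reach-val snd   e W = step-⌊⌋ (valᵀ e 1 ⟨ 4 , 0 ⟩ᵀ W) ◅ ε
reach-val orc   e W = step-⌊⌋ (valᵀ e 1 ⟨ 5 , 0 ⟩ᵀ W) ◅ ε
reach-val (comp f g) e W =
  step-⌊⌋ (valᵀ e 1 (node (leaf 6) ⟨ encode f , encode g ⟩ᵀ) W) ◅ reach-val f e _ ◅◅ reach-val g e W
reach-val (pair f g) e W =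
  step-⌊⌋ (valᵀ e 1 (node (leaf 7) ⟨ encode f , encode g ⟩ᵀ) W) ◅ reach-val f e _ ◅◅ reach-val g e W
reach-val (prec f g) e W =
  step-⌊⌋ (valᵀ e 1 (node (leaf 8) ⟨ encode f , encode g ⟩ᵀ) W) ◅ reach-val f e _ ◅◅ reach-val g e W
reach-val (mu f) e W = step-⌊⌋ (valᵀ e 1 ⟨ 9 , encode f ⟩ᵀ W) ◅ reach-val f e W

reach⇒fold : ∀ {s t} → Reach s t → Σ ℕ λ j → fold s step j ≡ t
reach⇒fold ε = 0 , refl
reach⇒fold {s} (refl ◅ r) with reach⇒fold r
... | j , eq = suc j , trans (trans (cong (fold s step) (+-comm 1 j)) (fold-+ s step j)) eq

haltsWithin-complete : ∀ {e} → HaltingSet e → Σ ℕ λ j → T (haltsWithin? e j)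
haltsWithin-complete (code , enc≡e , m , E) with trans (encode≡enc code) enc≡e
... | refl with reach⇒fold (reach-val code _ nil ◅◅ step-val-done (encode code) 0 ◅ reach-ev E nil)
... | j , eq = j , subst (T ∘ final?) (sym eq) (final-rt m 0)

final-decider : Decider noOracle final?
final-decider = (π₁ᶜ argᶜ ==ᵈ litᶜ 1) ∧ᵈ (π₁ᶜ (π₂ᶜ (π₂ᶜ argᶜ)) ==ᵈ litᶜ 0)

haltsWithin-decider : Decider noOracle (λ x → haltsWithin? (π₁ x) (π₂ x))
haltsWithin-decider = final-decider ∘ᵈ run
  where
  run : Computer noOracle (λ x → fold (start (π₁ x)) step (π₂ x))
  run = record
    { expr     = foldᵉ (valᵉ (π₁ᵉ argᵉ) (consᵉ (π₁ᵉ argᵉ) ⟨ litᵉ 0 , litᵉ 0 ⟩ᵉ)) stepᵉ (π₂ᵉ argᵉ)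
    ; computes = λ x → cong (λ f → fold (start (π₁ x)) f (π₂ x)) ⟦stepᵉ⟧≡step }

-- Only the first stage counts, so every program contributes at most one triangle to the graph.
haltsAt? : ℕ → ℕ → Bool
haltsAt? e s = haltsWithin? e s ∧ not (haltsWithin? e (s ∸ 1))

HaltsAt : ℕ → ℕ → Set
HaltsAt e s = T (haltsAt? e s)

haltsAt-decider : Decider noOracle (λ x → haltsAt? (π₁ x) (π₂ x))
haltsAt-decider =
  haltsWithin-decider ∧ᵈ notᵈ (apply₂ᵈ {P = haltsWithin?} haltsWithin-decider (π₁ᶜ argᶜ) (π₂ᶜ argᶜ ∸ᶜ litᶜ 1))

haltsWithin-zero : ∀ e → ¬ T (haltsWithin? e 0)
haltsWithin-zero e fin rewrite π₁-⟨⟩ 2 ⟨ e , cons e nil ⟩ = fin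

haltsWithin-mono : ∀ {e j k} → j ≤ k → T (haltsWithin? e j) → T (haltsWithin? e k)
haltsWithin-mono {e} {j} {k} j≤k fin = subst (T ∘ haltsWithin? e) (m+[n∸m]≡n j≤k) (go (k ∸ j))
  where
  go : ∀ d → T (haltsWithin? e (j + d))
  go zero    = subst (T ∘ haltsWithin? e) (sym (+-identityʳ j)) fin
  go (suc d) = subst (T ∘ haltsWithin? e) (sym (+-suc j d)) (subst (T ∘ final?) (sym (final-fixed (go d))) (go d))

T-∧-not : ∀ {p q} → T (p ∧ not q) → T p × ¬ T q
T-∧-not {true} {false} _ = _ , λ ()

haltsAt-sound : ∀ {e s} → HaltsAt e s → HaltingSet e
haltsAt-sound {e} {s} at = haltsWithin-sound {e} {s} (proj₁ (T-∧-not {haltsWithin? e s} at))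

haltsAt-first : ∀ {e s s′} → HaltsAt e s → s′ < s → ¬ T (haltsWithin? e s′)
haltsAt-first {e} {s} at s′<s fin =
  proj₂ (T-∧-not {haltsWithin? e s} at) (haltsWithin-mono (≤-pred (≤-trans s′<s (m≤n+m∸n s 1))) fin)

haltsAt-unique : ∀ {e s s′} → HaltsAt e s → HaltsAt e s′ → s ≡ s′
haltsAt-unique {e} {s} {s′} at at′ with <-cmp s s′
... | tri< s<s′ _ _ = ⊥-elim (haltsAt-first at′ s<s′ (proj₁ (T-∧-not {haltsWithin? e s} at)))
... | tri≈ _ s≡s′ _ = s≡s′
... | tri> _ _ s′<s = ⊥-elim (haltsAt-first at s′<s (proj₁ (T-∧-not {haltsWithin? e s′} at′)))

haltsAt-complete : ∀ {e} → HaltingSet e → Σ ℕ (HaltsAt e)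
haltsAt-complete {e} h = first (proj₁ (haltsWithin-complete h)) (proj₂ (haltsWithin-complete h))
  where
  first : ∀ j → T (haltsWithin? e j) → Σ ℕ (HaltsAt e)
  first zero    fin = ⊥-elim (haltsWithin-zero e fin)
  first (suc j) fin with haltsWithin? e j in eq
  ... | true  = first j (subst T (sym eq) _)
  ... | false =
    suc j , subst (λ b → T (haltsWithin? e (suc j) ∧ not b)) (sym eq) (subst T (sym (∧-identityʳ _)) fin)

-- r_a = ray a; the triangle of a program e that halts exactly at stage s is formed by
-- ray (1 + e), gadget e s 0 and gadget e s 1.
ray : ℕ → ℕ
ray a = ⟨ a , 0 ⟩

gadget : ℕ → ℕ → ℕ → ℕ
gadget e s i = ⟨ 2 + e , suc ⟨ s , i ⟩ ⟩

level : ℕ → ℕ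
level = π₁

level-ray : ∀ a → level (ray a) ≡ a
level-ray a = π₁-⟨⟩ a 0

level-gadget : ∀ e s i → level (gadget e s i) ≡ 2 + e
level-gadget e s i = π₁-⟨⟩ (2 + e) _

vertexAt? : ℕ → ℕ → Bool
vertexAt? a b = (b ≡ᵇ 0) ∨ ((2 ≤ᵇ a) ∧ ((π₂ (b ∸ 1) ≤ᵇ 1) ∧ haltsAt? (a ∸ 2) (π₁ (b ∸ 1))))

vertex? : ℕ → Bool
vertex? x = vertexAt? (π₁ x) (π₂ x)

lowerNeighbour? : ℕ → ℕ → ℕ → Bool
lowerNeighbour? a b u = ((1 ≤ᵇ a) ∧ (u ≡ᵇ ray (a ∸ 1)))
                       ∨ ((π₂ (b ∸ 1) ≡ᵇ 1) ∧ (u ≡ᵇ ⟨ a , suc ⟨ π₁ (b ∸ 1) , 0 ⟩ ⟩))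

link? : ℕ → ℕ → Bool
link? v u = vertex? v ∧ lowerNeighbour? (π₁ v) (π₂ v) u

edge? : ℕ → ℕ → Bool
edge? u v = link? u v ∨ link? v u

data Vertex : ℕ → Set where
  ray-vertex    : ∀ a → Vertex (ray a)
  gadget-vertex : ∀ {e s} i → i ≤ 1 → HaltsAt e s → Vertex (gadget e s i)

data Link : ℕ → ℕ → Set where
  spine  : ∀ a → Link (ray (suc a)) (ray a)
  attach : ∀ {e s} i → i ≤ 1 → HaltsAt e s → Link (gadget e s i) (ray (suc e))
  chord  : ∀ {e s} → HaltsAt e s → Link (gadget e s 1) (gadget e s 0)

vertexAt-sound : ∀ a b → T (vertexAt? a b) → Vertex ⟨ a , b ⟩
vertexAt-sound a zero _ = ray-vertex a
vertexAt-sound (suc (suc e)) (suc m) h with Equivalence.to T-∧ h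
... | i≤1 , halts =
  subst Vertex (cong (λ m → ⟨ 2 + e , suc m ⟩) (⟨π₁,π₂⟩ m)) (gadget-vertex (π₂ m) (≤ᵇ⇒≤ _ 1 i≤1) halts)

vertex-sound : ∀ x → T (vertex? x) → Vertex x
vertex-sound = ⟨⟩-elim (λ x → T (vertex? x) → Vertex x) λ a b h →
  vertexAt-sound a b (subst id (unpair₂ λ a b → T (vertexAt? a b)) h)

at-⟨⟩ : ∀ (P : ℕ → ℕ → Bool) {a b} → T (P a b) → T (P (π₁ ⟨ a , b ⟩) (π₂ ⟨ a , b ⟩))
at-⟨⟩ P = subst id (sym (unpair₂ λ a b → T (P a b)))

vertex-complete : ∀ {x} → Vertex x → T (vertex? x)
vertex-complete (ray-vertex a) = at-⟨⟩ vertexAt? {a} {0} _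
vertex-complete (gadget-vertex {e} {s} i i≤1 halts) = at-⟨⟩ vertexAt? {2 + e} {suc ⟨ s , i ⟩} gadget-ok
  where
  gadget-ok : T ((π₂ ⟨ s , i ⟩ ≤ᵇ 1) ∧ haltsAt? e (π₁ ⟨ s , i ⟩))
  gadget-ok rewrite π₁-⟨⟩ s i | π₂-⟨⟩ s i = Equivalence.from T-∧ (≤⇒≤ᵇ i≤1 , halts)

link-sound : ∀ v u → T (link? v u) → Link v u
link-sound v u h with Equivalence.to T-∧ h
... | v-ok , lower with vertex-sound v v-ok
... | ray-vertex a = ray-link a (subst id (unpair₂ λ a b → T (lowerNeighbour? a b u)) lower)
  where
  no-chord : ∀ {b} → ¬ T ((π₂ 0 ≡ᵇ 1) ∧ b)
  no-chord h = subst (λ n → T (n ≡ᵇ 1)) π₂-0 (proj₁ (Equivalence.to T-∧ h))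

  ray-link : ∀ a → T (lowerNeighbour? a 0 u) → Link (ray a) u
  ray-link zero    h = ⊥-elim (no-chord h)
  ray-link (suc a) h with Equivalence.to T-∨ h
  ... | inj₁ u≡  = subst (Link (ray (suc a))) (sym (≡ᵇ⇒≡ u (ray a) u≡)) (spine a)
  ... | inj₂ top = ⊥-elim (no-chord top)
... | gadget-vertex {e} {s} i i≤1 halts =
  gadget-link (subst id (unpair₂ λ a b → T (lowerNeighbour? a b u)) lower)
  where
  gadget-link : T (lowerNeighbour? (2 + e) (suc ⟨ s , i ⟩) u) → Link (gadget e s i) u
  gadget-link h with Equivalence.to T-∨ h
  ... | inj₁ u≡ = subst (Link (gadget e s i)) (sym (≡ᵇ⇒≡ u (ray (suc e)) u≡)) (attach i i≤1 halts)
  ... | inj₂ top rewrite π₁-⟨⟩ s i | π₂-⟨⟩ s i with Equivalence.to T-∧ top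
  ... | i≡1 , u≡ with ≡ᵇ⇒≡ i 1 i≡1
  ... | refl = subst (Link (gadget e s 1)) (sym (≡ᵇ⇒≡ u (gadget e s 0) u≡)) (chord halts)

link-source : ∀ {v u} → Link v u → Vertex v
link-source (spine a)             = ray-vertex (suc a)
link-source (attach i i≤1 halts)  = gadget-vertex i i≤1 halts
link-source (chord halts)         = gadget-vertex 1 ≤-refl halts

link-target : ∀ {v u} → Link v u → Vertex u
link-target (spine a)             = ray-vertex a
link-target (attach i i≤1 halts)  = ray-vertex _
link-target (chord halts)         = gadget-vertex 0 z≤n halts

link-complete : ∀ {v u} → Link v u → T (link? v u)
link-complete {v} {u} l = Equivalence.from T-∧ (vertex-complete (link-source l) , lower l)
  where
  lower-at : ∀ {a b} → T (lowerNeighbour? a b u) →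
             T (lowerNeighbour? (π₁ ⟨ a , b ⟩) (π₂ ⟨ a , b ⟩) u)
  lower-at = at-⟨⟩ λ a b → lowerNeighbour? a b u

  lower : Link v u → T (lowerNeighbour? (π₁ v) (π₂ v) u)
  lower (spine a)                = lower-at (Equivalence.from T-∨ (inj₁ (≡⇒≡ᵇ u u refl)))
  lower (attach i i≤1 halts)     = lower-at (Equivalence.from T-∨ (inj₁ (≡⇒≡ᵇ u u refl)))
  lower (chord {e} {s} halts)    = lower-at (Equivalence.from T-∨ (inj₂ chord-ok))
    where
    chord-ok : T ((π₂ ⟨ s , 1 ⟩ ≡ᵇ 1) ∧ (gadget e s 0 ≡ᵇ ⟨ 2 + e , suc ⟨ π₁ ⟨ s , 1 ⟩ , 0 ⟩ ⟩))
    chord-ok rewrite π₁-⟨⟩ s 1 | π₂-⟨⟩ s 1 = ≡⇒≡ᵇ (gadget e s 0) _ refl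

ray-injective : ∀ {a b} → ray a ≡ ray b → a ≡ b
ray-injective = ⟨⟩-injectiveˡ

ray≢gadget : ∀ {a e s i} → ray a ≢ gadget e s i
ray≢gadget eq = 0≢1+n (⟨⟩-injectiveʳ eq)

gadget-injective : ∀ {e s i e′ s′ i′} →
                   gadget e s i ≡ gadget e′ s′ i′ → e ≡ e′ × s ≡ s′ × i ≡ i′
gadget-injective eq = let si≡ = suc-injective (⟨⟩-injectiveʳ eq) in
  suc-injective (suc-injective (⟨⟩-injectiveˡ eq)) , ⟨⟩-injectiveˡ si≡ , ⟨⟩-injectiveʳ si≡

link-irreflexive : ∀ {v u} → Link v u → v ≢ u
link-irreflexive (spine a)            eq = 1+n≢n (ray-injective eq)
link-irreflexive (attach i i≤1 halts) eq = ray≢gadget (sym eq)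
link-irreflexive (chord halts)        eq = 1+n≢0 (proj₂ (proj₂ (gadget-injective eq)))

T⇒≡true : ∀ {b} → T b → b ≡ true
T⇒≡true = Equivalence.to T-≡

≡true⇒T : ∀ {b} → b ≡ true → T b
≡true⇒T = Equivalence.from T-≡

link?-irreflexive : ∀ u → link? u u ≡ false
link?-irreflexive u with link? u u in eq
... | false = refl
... | true  = ⊥-elim (link-irreflexive (link-sound u u (≡true⇒T eq)) refl)

edge⇒vertex : ∀ u v → edge? u v ≡ true → vertex? u ≡ true
edge⇒vertex u v e with Equivalence.to T-∨ (≡true⇒T e)
... | inj₁ uv = T⇒≡true (vertex-complete (link-source (link-sound u v uv)))
... | inj₂ vu = T⇒≡true (vertex-complete (link-target (link-sound v u vu)))

G : Graph
G = record
  { V     = vertex?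
  ; E     = edge?
  ; E-sym = λ u v → ∨-comm (link? u v) (link? v u)
  ; E-irr = λ u → cong₂ _∨_ (link?-irreflexive u) (link?-irreflexive u)
  ; E-V   = edge⇒vertex
  }

adj⇒link : ∀ {u v} → Adj G u v → Link u v ⊎ Link v u
adj⇒link {u} {v} a with Equivalence.to T-∨ (≡true⇒T a)
... | inj₁ uv = inj₁ (link-sound u v uv)
... | inj₂ vu = inj₂ (link-sound v u vu)

link⇒adj : ∀ {u v} → Link u v → Adj G u v
link⇒adj l = T⇒≡true (Equivalence.from T-∨ (inj₁ (link-complete l)))

link⇒adj′ : ∀ {u v} → Link v u → Adj G u v
link⇒adj′ l = T⇒≡true (Equivalence.from T-∨ (inj₂ (link-complete l)))

vertex⇒Vertex : ∀ {x} → Vtx G x → Vertex x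
vertex⇒Vertex {x} h = vertex-sound x (≡true⇒T h)

Vertex⇒vertex : ∀ {x} → Vertex x → Vtx G x
Vertex⇒vertex = T⇒≡true ∘ vertex-complete

vertex-decider : Decider noOracle vertex?
vertex-decider =
  (π₂ᶜ argᶜ ==ᵈ litᶜ 0) ∨ᵈ
  ((litᶜ 2 ≤ᵈ π₁ᶜ argᶜ) ∧ᵈ
   ((π₂ᶜ predπ₂ ≤ᵈ litᶜ 1) ∧ᵈ apply₂ᵈ {P = haltsAt?} haltsAt-decider (π₁ᶜ argᶜ ∸ᶜ litᶜ 2) (π₁ᶜ predπ₂)))
  where
  predπ₂ : Computer noOracle (λ x → π₂ x ∸ 1)
  predπ₂ = π₂ᶜ argᶜ ∸ᶜ litᶜ 1

link-decider : Decider noOracle (λ x → link? (π₁ x) (π₂ x))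
link-decider =
  (vertex-decider ∘ᵈ v) ∧ᵈ
  (((litᶜ 1 ≤ᵈ π₁ᶜ v) ∧ᵈ (u ==ᵈ ⟨ π₁ᶜ v ∸ᶜ litᶜ 1 , litᶜ 0 ⟩ᶜ)) ∨ᵈ
   ((π₂ᶜ predπ₂v ==ᵈ litᶜ 1) ∧ᵈ (u ==ᵈ ⟨ π₁ᶜ v , sucᶜ ⟨ π₁ᶜ predπ₂v , litᶜ 0 ⟩ᶜ ⟩ᶜ)))
  where
  v : Computer noOracle π₁
  v = π₁ᶜ argᶜ
  u : Computer noOracle π₂
  u = π₂ᶜ argᶜ
  predπ₂v : Computer noOracle (λ x → π₂ (π₁ x) ∸ 1)
  predπ₂v = π₂ᶜ v ∸ᶜ litᶜ 1

edge-decider : Decider noOracle (λ x → edge? (π₁ x) (π₂ x))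
edge-decider = link-decider ∨ᵈ apply₂ᵈ {P = link?} link-decider (π₂ᶜ argᶜ) (π₁ᶜ argᶜ)

G-recursive : RecursiveGraph G
G-recursive = decider-program vertex-decider , edge-program
  where
  edge-program : Σ PR λ c → ∀ a b → Eval noOracle c ⟪ a , b ⟫ (b2n (edge? a b))
  edge-program with decider-program edge-decider
  ... | c , c↓ = c , λ a b →
    subst (Eval noOracle c ⟪ a , b ⟫) (cong₂ (λ u v → b2n (edge? u v)) (π₁-⟪⟫ a b) (π₂-⟪⟫ a b)) (c↓ ⟪ a , b ⟫)

data RayNeighbour (a : ℕ) : ℕ → Set where
  down   : RayNeighbour a (ray a)
  up     : RayNeighbour a (ray (2 + a))
  hanger : ∀ {s} i → i ≤ 1 → HaltsAt a s → RayNeighbour a (gadget a s i)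

data GadgetNeighbour (e s : ℕ) : ℕ → ℕ → Set where
  base  : ∀ {i} → GadgetNeighbour e s i (ray (suc e))
  other : GadgetNeighbour e s 0 (gadget e s 1)
  other′ : GadgetNeighbour e s 1 (gadget e s 0)

ray-neighbour : ∀ {a y} → Adj G (ray (suc a)) y → RayNeighbour a y
ray-neighbour {a} {y} adj with adj⇒link adj
... | inj₁ l = from l refl
  where
  from : ∀ {v} → Link v y → v ≡ ray (suc a) → RayNeighbour a y
  from (spine b)      eq with suc-injective (ray-injective eq)
  ... | refl = down
  from (attach _ _ _) eq = ⊥-elim (ray≢gadget (sym eq))
  from (chord _)      eq = ⊥-elim (ray≢gadget (sym eq))
... | inj₂ l = to l refl
  where
  to : ∀ {u} → Link y u → u ≡ ray (suc a) → RayNeighbour a y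
  to (spine b)            eq with ray-injective eq
  ... | refl = up
  to (attach i i≤1 halts) eq with suc-injective (ray-injective eq)
  ... | refl = hanger i i≤1 halts
  to (chord _)            eq = ⊥-elim (ray≢gadget (sym eq))

ray₀-neighbour : ∀ {y} → Adj G (ray 0) y → y ≡ ray 1
ray₀-neighbour {y} adj with adj⇒link adj
... | inj₁ l = from l refl
  where
  from : ∀ {v} → Link v y → v ≡ ray 0 → y ≡ ray 1
  from (spine b)      eq = ⊥-elim (1+n≢0 (ray-injective eq))
  from (attach _ _ _) eq = ⊥-elim (ray≢gadget (sym eq))
  from (chord _)      eq = ⊥-elim (ray≢gadget (sym eq))
... | inj₂ l = to l refl
  where
  to : ∀ {u} → Link y u → u ≡ ray 0 → y ≡ ray 1
  to (spine b)      eq = cong (ray ∘ suc) (ray-injective eq)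
  to (attach _ _ _) eq = ⊥-elim (1+n≢0 (ray-injective eq))
  to (chord _)      eq = ⊥-elim (ray≢gadget (sym eq))

gadget-neighbour : ∀ {e s i y} → Adj G (gadget e s i) y → GadgetNeighbour e s i y
gadget-neighbour {e} {s} {i} {y} adj with adj⇒link adj
... | inj₁ l = from l refl
  where
  from : ∀ {v} → Link v y → v ≡ gadget e s i → GadgetNeighbour e s i y
  from (spine b)      eq = ⊥-elim (ray≢gadget eq)
  from (attach _ _ _) eq with gadget-injective eq
  ... | refl , refl , refl = base
  from (chord _)      eq with gadget-injective eq
  ... | refl , refl , refl = other′
... | inj₂ l = to l refl
  where
  to : ∀ {u} → Link y u → u ≡ gadget e s i → GadgetNeighbour e s i y
  to (spine b)      eq = ⊥-elim (ray≢gadget eq)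
  to (attach _ _ _) eq = ⊥-elim (ray≢gadget eq)
  to (chord _)      eq with gadget-injective eq
  ... | refl , refl , refl = other

adj-sym : ∀ {u v} → Adj G u v → Adj G v u
adj-sym {u} {v} = trans (E-sym G v u)

ray-path : ∀ a → Star (Adj G) (ray a) (ray 0)
ray-path zero    = ε
ray-path (suc a) = link⇒adj (spine a) ◅ ray-path a

vertex-path : ∀ {x} → Vertex x → Star (Adj G) x (ray 0)
vertex-path (ray-vertex a)             = ray-path a
vertex-path (gadget-vertex i i≤1 halts) = link⇒adj (attach i i≤1 halts) ◅ ray-path _

G-connected : Connected G
G-connected u v u-ok v-ok =
  vertex-path (vertex⇒Vertex u-ok) ◅◅ reverse adj-sym (vertex-path (vertex⇒Vertex v-ok))

degree-of : ∀ {v n} (l : List ℕ) → Unique l →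
            (∀ {u} → Adj G v u → u ∈ l) → (∀ {u} → u ∈ l → Adj G v u) → HasDegree G v n → n ≡ length l
degree-of l l-unique adj⇒∈ ∈⇒adj (l′ , l′-unique , len , nbrs) =
  trans (sym len) (↭-length (∼bag⇒↭ (unique∧set⇒bag l′-unique l-unique
    (mk⇔ (adj⇒∈ ∘ proj₁ (nbrs _)) (proj₂ (nbrs _) ∘ ∈⇒adj)))))

ray₀-degree : HasDegree G (ray 0) 1
ray₀-degree = ray 1 ∷ [] , [] ∷ [] , refl , λ u →
  (λ { (here refl) → link⇒adj′ (spine 0) }) , (λ adj → here (ray₀-neighbour adj))

a≢2+a : ∀ {a} → a ≢ 2 + a
a≢2+a {suc a} eq = a≢2+a (suc-injective eq)

-- Whether r_{a+1} carries a triangle is undecidable, but its neighbour list tells.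
ray-degree : ∀ a {n} → HasDegree G (ray (suc a)) n → n ≡ 2 ⊎ n ≡ 4
ray-degree a deg@(l , _ , _ , nbrs) with any? (λ y → ¬? (π₂ y ≟ 0)) l
... | yes hangs with find hangs
...   | y , y∈l , π₂y≢0 with ray-neighbour (proj₁ (nbrs y) y∈l)
...     | down  = ⊥-elim (π₂y≢0 (π₂-⟨⟩ a 0))
...     | up    = ⊥-elim (π₂y≢0 (π₂-⟨⟩ (2 + a) 0))
...     | hanger {s} _ _ halts = inj₂ (degree-of four four-unique adj⇒∈ ∈⇒adj deg)
  where
  four : List ℕ
  four = ray a ∷ ray (2 + a) ∷ gadget a s 0 ∷ gadget a s 1 ∷ []

  four-unique : Unique four
  four-unique = (a≢2+a ∘ ray-injective ∷ ray≢gadget ∷ ray≢gadget ∷ [])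
              ∷ (ray≢gadget ∷ ray≢gadget ∷ [])
              ∷ ((λ eq → 0≢1+n (proj₂ (proj₂ (gadget-injective eq)))) ∷ [])
              ∷ [] ∷ []

  adj⇒∈ : ∀ {u} → Adj G (ray (suc a)) u → u ∈ four
  adj⇒∈ adj with ray-neighbour adj
  ... | down = here refl
  ... | up   = there (here refl)
  ... | hanger {s′} i i≤1 halts′ with haltsAt-unique {a} {s} {s′} halts halts′ | i | i≤1
  ...   | refl | 0 | _ = there (there (here refl))
  ...   | refl | 1 | _ = there (there (there (here refl)))
  ...   | refl | suc (suc _) | s≤s ()

  ∈⇒adj : ∀ {u} → u ∈ four → Adj G (ray (suc a)) u
  ∈⇒adj (here refl)                         = link⇒adj (spine a)
  ∈⇒adj (there (here refl))                 = link⇒adj′ (spine (suc a))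
  ∈⇒adj (there (there (here refl)))         = link⇒adj′ (attach 0 z≤n halts)
  ∈⇒adj (there (there (there (here refl)))) = link⇒adj′ (attach 1 ≤-refl halts)
ray-degree a deg@(l , _ , _ , nbrs) | no no-hanger = inj₁ (degree-of two two-unique adj⇒∈ ∈⇒adj deg)
  where
  two : List ℕ
  two = ray a ∷ ray (2 + a) ∷ []

  two-unique : Unique two
  two-unique = (a≢2+a ∘ ray-injective ∷ []) ∷ [] ∷ []

  adj⇒∈ : ∀ {u} → Adj G (ray (suc a)) u → u ∈ two
  adj⇒∈ adj with ray-neighbour adj
  ... | down = here refl
  ... | up   = there (here refl)
  ... | hanger i _ _ = ⊥-elim (no-hanger (lose (proj₂ (nbrs _) adj) (1+n≢0 ∘ trans (sym (π₂-⟨⟩ (2 + a) _)))))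

  ∈⇒adj : ∀ {u} → u ∈ two → Adj G (ray (suc a)) u
  ∈⇒adj (here refl)         = link⇒adj (spine a)
  ∈⇒adj (there (here refl)) = link⇒adj′ (spine (suc a))

gadget-degree : ∀ {e s} i {n} → i ≤ 1 → HaltsAt e s → HasDegree G (gadget e s i) n → n ≡ 2
gadget-degree {e} {s} i i≤1 halts = degree-of two ((ray≢gadget ∷ []) ∷ [] ∷ []) adj⇒∈ (∈⇒adj i i≤1)
  where
  two : List ℕ
  two = ray (suc e) ∷ gadget e s (1 ∸ i) ∷ []

  adj⇒∈ : ∀ {u} → Adj G (gadget e s i) u → u ∈ two
  adj⇒∈ adj with gadget-neighbour adj
  ... | base   = here refl
  ... | other  = there (here refl)
  ... | other′ = there (here refl)

  ∈⇒adj : ∀ i → i ≤ 1 → ∀ {u} → u ∈ ray (suc e) ∷ gadget e s (1 ∸ i) ∷ [] → Adj G (gadget e s i) u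
  ∈⇒adj i i≤1 (here refl)         = link⇒adj (attach i i≤1 halts)
  ∈⇒adj 0 _   (there (here refl)) = link⇒adj′ (chord halts)
  ∈⇒adj 1 _   (there (here refl)) = link⇒adj (chord halts)
  ∈⇒adj (suc (suc _)) (s≤s ())

even-not-odd : ∀ {n} k → n ≡ 2 * k → ¬ Odd n
even-not-odd k refl (k′ , eq) = even≢odd k k′ eq

odd⇒ray₀ : ∀ {x} → Vertex x → HasOddDegree G x → x ≡ ray 0
odd⇒ray₀ (ray-vertex zero)    _ = refl
odd⇒ray₀ (ray-vertex (suc a)) (n , deg , odd) with ray-degree a deg
... | inj₁ refl = ⊥-elim (even-not-odd 1 refl odd)
... | inj₂ refl = ⊥-elim (even-not-odd 2 refl odd)
odd⇒ray₀ (gadget-vertex i i≤1 halts) (n , deg , odd) with gadget-degree i i≤1 halts deg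
... | refl = ⊥-elim (even-not-odd 1 refl odd)

endpoint-bound : List (ℕ × ℕ) → ℕ
endpoint-bound []              = 0
endpoint-bound ((x , y) ∷ h) = level x + level y + endpoint-bound h

∈⇒bounded : ∀ {x y} h → (x , y) ∈ h → level x ≤ endpoint-bound h × level y ≤ endpoint-bound h
∈⇒bounded ((x , y) ∷ h) (here refl) =
  ≤-trans (m≤m+n (level x) (level y)) (m≤m+n _ _) , ≤-trans (m≤n+m (level y) (level x)) (m≤m+n _ _)
∈⇒bounded ((x′ , y′) ∷ h) (there m) with ∈⇒bounded h m
... | x≤ , y≤ = ≤-trans x≤ (m≤n+m _ _) , ≤-trans y≤ (m≤n+m _ _)

module AfterRemoving (h : List (ℕ × ℕ)) where

  N : ℕ
  N = suc (endpoint-bound h)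

  _—_ : ℕ → ℕ → Set
  _—_ = AdjMinus G h

  beyond⇒∉ : ∀ {x y} → N ≤ level x ⊎ N ≤ level y → (x , y) ∉ h
  beyond⇒∉ (inj₁ N≤x) m = <⇒≱ N≤x (proj₁ (∈⇒bounded h m))
  beyond⇒∉ (inj₂ N≤y) m = <⇒≱ N≤y (proj₂ (∈⇒bounded h m))

  beyond-edge : ∀ {x y} → Adj G x y → N ≤ level x ⊎ N ≤ level y → x — y
  beyond-edge adj beyond = adj , beyond⇒∉ beyond , beyond⇒∉ (swap beyond)

  —-sym : ∀ {x y} → x — y → y — x
  —-sym (adj , ∉h , ∉h′) = adj-sym adj , ∉h′ , ∉h

  tail-spine : ∀ d → Star _—_ (ray N) (ray (d + N))
  tail-spine zero    = ε
  tail-spine (suc d) = tail-spine d ◅◅ beyond-edge (link⇒adj′ (spine (d + N))) (inj₁ N≤) ◅ ε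
    where
    N≤ : N ≤ level (ray (d + N))
    N≤ = subst (N ≤_) (sym (level-ray (d + N))) (m≤n+m N d)

  tail-path : ∀ {x} → Vertex x → N < level x → Star _—_ (ray N) x
  tail-path (ray-vertex a) N<x with subst (N <_) (level-ray a) N<x
  ... | N<a = subst (Star _—_ (ray N) ∘ ray) (m∸n+n≡m (<⇒≤ N<a)) (tail-spine (a ∸ N))
  tail-path (gadget-vertex {e} i i≤1 halts) N<x with subst (N <_) (level-gadget e _ i) N<x
  ... | s≤s N≤1+e = subst (Star _—_ (ray N) ∘ ray) (m∸n+n≡m N≤1+e) (tail-spine (suc e ∸ N)) ◅◅
                    beyond-edge (link⇒adj′ (attach i i≤1 halts))
                      (inj₂ (subst (N ≤_) (sym (level-gadget e _ i)) (m≤n⇒m≤1+n N≤1+e))) ◅ ε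

  ray-N-infinite : InInfiniteComponent G h (ray N)
  ray-N-infinite k = ray (k + suc N) , ≤-trans (m≤m+n k (suc N)) (≤-⟨⟩ˡ _ 0) , Vertex⇒vertex (ray-vertex _)
                   , tail-path (ray-vertex _) (subst (N <_) (sym (level-ray (k + suc N))) (m≤n+m (suc N) k))

  module _ {w : ℕ} (w-infinite : InInfiniteComponent G h w) where

    Known : ℕ → List ℕ → Set
    Known k S = ray N < k × (∀ {e s i} → HaltsAt e s → i ≤ 1 → 2 + e ≤ N → e ∉ S → gadget e s i < k)

    via-tail : ∀ {u} → Vertex u → N < level u → Star _—_ w u → Star _—_ (ray N) w
    via-tail u-vtx N<u w⇝u = tail-path u-vtx N<u ◅◅ reverse —-sym w⇝u

    gadget≤ : ∀ {e s i} → i ≤ 1 → gadget e s i ≤ gadget e s 0 + gadget e s 1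
    gadget≤ {i = 0} _         = m≤m+n _ _
    gadget≤ {i = 1} _         = m≤n+m _ _
    gadget≤ {i = suc (suc _)} (s≤s ())

    -- A low vertex met in the component of w is a gadget of some e ∈ S whose stage is thereby
    -- known; e leaves S, so the search ends after at most |S| rounds.
    search : ∀ fuel S k → length S < fuel → Known k S → Star _—_ (ray N) w
    search (suc fuel) S k |S|<fuel (rayN<k , known) with w-infinite k
    ... | u , k≤u , u-vtx , w⇝u = found (vertex⇒Vertex u-vtx) k≤u w⇝u
      where
      found : ∀ {u} → Vertex u → k ≤ u → Star _—_ w u → Star _—_ (ray N) w
      found (ray-vertex a) k≤u w⇝u with N <? a
      ... | yes N<a = via-tail (ray-vertex a) (subst (N <_) (sym (level-ray a)) N<a) w⇝u
      ... | no  N≮a = ⊥-elim (<⇒≱ (<-≤-trans rayN<k k≤u) (⟨_,0⟩-mono-≤ (≮⇒≥ N≮a)))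
      found (gadget-vertex {e} {s} i i≤1 halts) k≤u w⇝u with N <? 2 + e
      ... | yes N<2+e = via-tail (gadget-vertex i i≤1 halts) (subst (N <_) (sym (level-gadget e s i)) N<2+e) w⇝u
      ... | no  N≮2+e with e ∈? S
      ...   | no  e∉S = ⊥-elim (<⇒≱ (known halts i≤1 (≮⇒≥ N≮2+e) e∉S) k≤u)
      ...   | yes e∈S = search fuel S′ k′ |S′|<fuel (≤-trans rayN<k k≤k′ , known′)
        where
        S′ : List ℕ
        S′ = filter (λ x → ¬? (x ≟ e)) S

        k′ : ℕ
        k′ = suc (k + (gadget e s 0 + gadget e s 1))

        k≤k′ : k ≤ k′
        k≤k′ = m≤n⇒m≤1+n (m≤m+n k _)

        |S′|<fuel : length S′ < fuel
        |S′|<fuel = ≤-trans (filter-notAll (λ x → ¬? (x ≟ e)) S (Any.map (λ e≡x x≢e → x≢e (sym e≡x)) e∈S))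
                            (≤-pred |S|<fuel)

        known′ : ∀ {e′ s′ i′} → HaltsAt e′ s′ → i′ ≤ 1 → 2 + e′ ≤ N → e′ ∉ S′ → gadget e′ s′ i′ < k′
        known′ {e′} {s′} {i′} halts′ i′≤1 low e′∉S′ with e′ ≟ e
        ... | yes refl =
          subst (λ t → gadget e t i′ < k′) (haltsAt-unique halts halts′) (s≤s (≤-trans (gadget≤ i′≤1) (m≤n+m _ k)))
        ... | no  e′≢e =
          ≤-trans (known halts′ i′≤1 low (λ e′∈S → e′∉S′ (∈-filter⁺ (λ x → ¬? (x ≟ e)) e′∈S e′≢e))) k≤k′

    reach-from-ray-N : Star _—_ (ray N) w
    reach-from-ray-N =
      search (suc N) (upTo N) (suc (ray N)) (s≤s (≤-reflexive (length-upTo N))) (≤-refl , initially)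
      where
      initially : ∀ {e s i} → HaltsAt e s → i ≤ 1 → 2 + e ≤ N → e ∉ upTo N → gadget e s i < suc (ray N)
      initially _ _ low e∉ = ⊥-elim (e∉ (∈-upTo⁺ (≤-trans (n≤1+n _) low)))

G-pre-Eulerian : PreEulerian G
G-pre-Eulerian =
  G-connected , odd-unique , (λ no-odd → ⊥-elim (no-odd (ray 0) ray₀-vertex (1 , ray₀-degree , 0 , refl))) , tail
  where
  ray₀-vertex : Vtx G (ray 0)
  ray₀-vertex = Vertex⇒vertex (ray-vertex 0)

  odd-unique : ∀ u v → Vtx G u → Vtx G v → HasOddDegree G u → HasOddDegree G v → u ≡ v
  odd-unique u v u-ok v-ok u-odd v-odd =
    trans (odd⇒ray₀ (vertex⇒Vertex u-ok) u-odd) (sym (odd⇒ray₀ (vertex⇒Vertex v-ok) v-odd))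

  tail : ∀ (H : FiniteSubgraph G) → Σ ℕ λ v → Vtx G v × InInfiniteComponent G (proj₁ H) v ×
           (∀ w → Vtx G w → InInfiniteComponent G (proj₁ H) w → Star (AdjMinus G (proj₁ H)) v w)
  tail (h , _) = ray N , Vertex⇒vertex (ray-vertex N) , ray-N-infinite , λ _ _ → reach-from-ray-N
    where open AfterRemoving h

Least : (ℕ → Set) → ℕ → Set
Least Q m = Q m × (∀ z → z < m → ¬ Q z)

least : ∀ (Q : ℕ → Set) → (∀ n → Dec (Q n)) → ∀ {j} → Q j → Σ ℕ (Least Q)
least Q Q? {j} qj = go j 0 (+-identityʳ j) (λ _ ())
  where
  go : ∀ d b → d + b ≡ j → (∀ z → z < b → ¬ Q z) → Σ ℕ (Least Q)
  go d b d+b≡j below with Q? b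
  ... | yes qb = b , qb , below
  go zero    b refl  below | no ¬qb = ⊥-elim (¬qb qj)
  go (suc d) b d+b≡j below | no ¬qb = go d (suc b) (trans (+-suc d b) d+b≡j) below′
    where
    below′ : ∀ z → z < suc b → ¬ Q z
    below′ z z<1+b with m≤n⇒m<n∨m≡n (≤-pred z<1+b)
    ... | inj₁ z<b  = below z z<b
    ... | inj₂ refl = ¬qb

link-level : ∀ {v u} → Link v u → level u ≤ level v × level v ≤ suc (level u)
link-level (spine a) rewrite level-ray a | level-ray (suc a) = n≤1+n a , ≤-refl
link-level (attach {e} {s} i _ _) rewrite level-ray (suc e) | level-gadget e s i = n≤1+n (suc e) , ≤-refl
link-level (chord {e} {s} _) rewrite level-gadget e s 0 | level-gadget e s 1 = ≤-refl , n≤1+n _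

adj-level : ∀ {x y} → Adj G x y → level y ≤ suc (level x)
adj-level adj with adj⇒link adj
... | inj₁ l = m≤n⇒m≤1+n (proj₁ (link-level l))
... | inj₂ l = proj₂ (link-level l)

ray-neighbour-level : ∀ {a y} → Adj G (ray (suc a)) y → y ≡ ray a ⊎ level y ≡ 2 + a
ray-neighbour-level adj with ray-neighbour adj
... | down = inj₁ refl
... | up   = inj₂ (level-ray _)
... | hanger i _ _ = inj₂ (level-gadget _ _ i)

gadget-neighbour-level : ∀ {e s i y} → Adj G (gadget e s i) y → level y ≤ 2 + e
gadget-neighbour-level adj with gadget-neighbour adj
... | base   = ≤-trans (≤-reflexive (level-ray _)) (n≤1+n _)
... | other  = ≤-reflexive (level-gadget _ _ 1)
... | other′ = ≤-reflexive (level-gadget _ _ 0)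

module EulerPathOf (p : ℕ → ℕ) (euler : EulerPath G p) where

  walk : ∀ i → Adj G (p i) (p (suc i))
  walk = proj₁ euler

  Crosses : ℕ → ℕ → ℕ → Set
  Crosses i u v = SameEdge (p i) (p (suc i)) u v

  traversal : ∀ {u v} → Adj G u v → Σ ℕ λ i → Crosses i u v × (∀ j → Crosses j u v → j ≡ i)
  traversal = proj₂ euler _ _

  visited : ∀ i → Vertex (p i)
  visited i = vertex⇒Vertex (E-V G _ _ (walk i))

  ray₀-only-at-start : ∀ i → p (suc i) ≢ ray 0
  ray₀-only-at-start i p≡ with traversal (link⇒adj′ (spine 0))
  ... | _ , _ , once = 1+n≢n (trans (once (suc i) (inj₁ (p≡ , after))) (sym (once i (inj₂ (before , p≡)))))
    where
    before : p i ≡ ray 1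
    before = ray₀-neighbour (adj-sym (subst (Adj G (p i)) p≡ (walk i)))
    after : p (2 + i) ≡ ray 1
    after = ray₀-neighbour (subst (λ x → Adj G x (p (2 + i))) p≡ (walk (suc i)))

  starts-at-ray₀ : p 0 ≡ ray 0
  starts-at-ray₀ with traversal (link⇒adj′ (spine 0))
  ... | zero  , inj₁ (p₀≡ , _) , _ = p₀≡
  ... | suc i , inj₁ (p≡ , _)  , _ = ⊥-elim (ray₀-only-at-start i p≡)
  ... | i     , inj₂ (_ , p≡)  , _ = ⊥-elim (ray₀-only-at-start i p≡)

  module FirstVisit (e : ℕ) where

    AtLevel : ℕ → Set
    AtLevel j = level (p j) ≡ 2 + e

    bridge-crossed : Σ ℕ AtLevel
    bridge-crossed with traversal (link⇒adj′ (spine (suc e)))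
    ... | i , inj₁ (_ , p₁₊ᵢ≡) , _ = suc i , trans (cong level p₁₊ᵢ≡) (level-ray (2 + e))
    ... | i , inj₂ (pᵢ≡ , _) , _   = i , trans (cong level pᵢ≡) (level-ray (2 + e))

    -- Opaque for the same reason as step.
    opaque
      first : Σ ℕ (Least AtLevel)
      first = least AtLevel (λ j → level (p j) ≟ 2 + e) (proj₂ bridge-crossed)

    J : ℕ
    J = proj₁ first

    at-J : AtLevel J
    at-J = proj₁ (proj₂ first)

    before-J : ∀ z → z < J → ¬ AtLevel z
    before-J = proj₂ (proj₂ first)

    below-J : ∀ z → z < J → level (p z) ≤ suc e
    below-J zero    _   = subst (_≤ suc e) (sym (trans (cong level starts-at-ray₀) (level-ray 0))) z≤n
    below-J (suc z) z<J
      with m≤n⇒m<n∨m≡n (≤-trans (adj-level (walk z)) (s≤s (below-J z (<-trans (n<1+n z) z<J))))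
    ... | inj₁ lt = ≤-pred lt
    ... | inj₂ eq = ⊥-elim (before-J (suc z) z<J eq)

    at-level-gadget : ∀ {e′ s i} → level (gadget e′ s i) ≡ 2 + e → e′ ≡ e
    at-level-gadget {e′} eq = suc-injective (suc-injective (trans (sym (level-gadget e′ _ _)) eq))

    at-level : ∀ {x} → Vertex x → level x ≡ 2 + e →
               x ≡ ray (2 + e) ⊎ Σ ℕ λ s → HaltsAt e s × Σ ℕ λ i → x ≡ gadget e s i
    at-level (ray-vertex a) lvl = inj₁ (cong ray (trans (sym (level-ray a)) lvl))
    at-level (gadget-vertex {e′} {s} i _ halts) lvl with at-level-gadget {e′} {s} {i} lvl
    ... | refl = inj₂ (s , halts , i , refl)

    not-halting : ¬ HaltingSet e → π₂ (p J) ≡ 0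
    not-halting ¬halts with at-level (visited J) at-J
    ... | inj₁ p-J≡ = trans (cong π₂ p-J≡) (π₂-⟨⟩ (2 + e) 0)
    ... | inj₂ (s , halts , _) = ⊥-elim (¬halts (haltsAt-sound {e} {s} halts))

    Beyond : ℕ → Set
    Beyond x = x ≡ ray (2 + e) ⊎ 3 + e ≤ level x

    module Crossed {s j : ℕ} (halts : HaltsAt e s) (p-1+j≡ : p (suc j) ≡ ray (2 + e))
                   (below : ∀ z → z < suc j → level (p z) ≤ suc e) where

      bridge-at-j : p j ≡ ray (suc e)
      bridge-at-j with ray-neighbour-level (adj-sym (subst (Adj G (p j)) p-1+j≡ (walk j)))
      ... | inj₁ p-j≡ = p-j≡
      ... | inj₂ lvl  = ⊥-elim (<⇒≱ (≤-trans (n≤1+n _) (≤-reflexive (sym lvl))) (below j ≤-refl))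

      bridge-once : ∀ i → Crosses i (ray (suc e)) (ray (2 + e)) → i ≡ j
      bridge-once i crosses with traversal (link⇒adj′ (spine (suc e)))
      ... | _ , _ , once = trans (once i crosses) (sym (once j (inj₁ (bridge-at-j , p-1+j≡))))

      stays-beyond : ∀ d → Beyond (p (d + suc j))
      stays-beyond zero = inj₁ p-1+j≡
      stays-beyond (suc d) with stays-beyond d
      ... | inj₁ p≡
        with ray-neighbour-level (subst (λ x → Adj G x (p (suc (d + suc j)))) p≡ (walk (d + suc j)))
      ...   | inj₁ next≡ = ⊥-elim (m+1+n≢n d (bridge-once (d + suc j) (inj₂ (p≡ , next≡))))
      ...   | inj₂ lvl   = inj₂ (≤-reflexive (sym lvl))
      stays-beyond (suc d) | inj₂ far with 3 + e ≤? level (p (suc (d + suc j)))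
      ... | yes far′ = inj₂ far′
      ... | no  near with at-level (visited (suc (d + suc j))) (≤-antisym (≮⇒≥ near)
                            (≤-pred (≤-trans far (adj-level (adj-sym (walk (d + suc j)))))))
      ...   | inj₁ p≡ = inj₁ p≡
      ...   | inj₂ (_ , _ , _ , p≡) =
              ⊥-elim (<⇒≱ far (gadget-neighbour-level
                (subst (λ y → Adj G y (p (d + suc j))) p≡ (adj-sym (walk (d + suc j))))))

      gadget-never : ∀ m → p m ≢ gadget e s 0
      gadget-never m p≡ with m <? suc j
      ... | yes m<1+j = <⇒≱ (≤-reflexive (sym (trans (cong level p≡) (level-gadget e s 0)))) (below m m<1+j)
      ... | no  m≮1+j with subst (Beyond ∘ p) (m∸n+n≡m (≮⇒≥ m≮1+j)) (stays-beyond (m ∸ suc j))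
      ...   | inj₁ p≡′ = ray≢gadget (trans (sym p≡′) p≡)
      ...   | inj₂ far = <⇒≱ far (≤-reflexive (trans (cong level p≡) (level-gadget e s 0)))

      contradiction : ⊥
      contradiction with traversal (link⇒adj′ (attach 0 z≤n halts))
      ... | i , inj₁ (_ , p≡) , _ = gadget-never (suc i) p≡
      ... | i , inj₂ (p≡ , _) , _ = gadget-never i p≡

    no-crossing : ∀ {s} → HaltsAt e s → ∀ j → p j ≡ ray (2 + e) → (∀ z → z < j → level (p z) ≤ suc e) → ⊥
    no-crossing halts zero p₀≡ _ =
      0≢1+n (trans (sym (level-ray 0)) (trans (cong level (trans (sym starts-at-ray₀) p₀≡)) (level-ray (2 + e))))
    no-crossing {s} halts (suc j) p≡ below = Crossed.contradiction {s} {j} halts p≡ below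

    halting : HaltingSet e → π₂ (p J) ≢ 0
    halting h π₂≡0 with haltsAt-complete h | at-level (visited J) at-J
    ... | s , halts | inj₁ p≡ = no-crossing {s} halts J p≡ below-J
    ... | _ | inj₂ (_ , _ , _ , p≡) = 1+n≢0 (trans (sym (π₂-⟨⟩ (2 + e) _)) (trans (cong π₂ (sym p≡)) π₂≡0))

  first-visit-finder : Decider p (λ x → not (level (p (π₂ x)) ≡ᵇ 2 + π₁ x))
  first-visit-finder = notᵈ (π₁ᶜ (oracleᶜ (π₂ᶜ argᶜ)) ==ᵈ sucᶜ (sucᶜ (π₁ᶜ argᶜ)))

  answer : Decider p (λ x → not (π₂ (p (π₂ x)) ≡ᵇ 0))
  answer = notᵈ (π₂ᶜ (oracleᶜ (π₂ᶜ argᶜ)) ==ᵈ litᶜ 0)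

  finder-program answer-program : PR
  finder-program = proj₁ (decider-program first-visit-finder)
  answer-program = proj₁ (decider-program answer)

  decide-halting : PR
  decide-halting = comp answer-program (pair ident (mu finder-program))

  decide-halting-runs : ∀ e → Eval p decide-halting e (b2n (not (π₂ (p (FirstVisit.J e)) ≡ᵇ 0)))
  decide-halting-runs e = e-comp (e-pair (e-ident e) (e-mu found earlier))
    (subst (Eval p answer-program ⟪ e , J ⟫) (cong (λ j → b2n (not (π₂ (p j) ≡ᵇ 0))) (π₂-⟪⟫ e J))
      (proj₂ (decider-program answer) ⟪ e , J ⟫))
    where
    open FirstVisit e
    finder↓ : ∀ j → Eval p finder-program ⟪ e , j ⟫ (b2n (not (level (p j) ≡ᵇ 2 + e)))
    finder↓ j = subst (Eval p finder-program ⟪ e , j ⟫)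
                  (cong₂ (λ a j → b2n (not (level (p j) ≡ᵇ 2 + a))) (π₁-⟪⟫ e j) (π₂-⟪⟫ e j))
                  (proj₂ (decider-program first-visit-finder) ⟪ e , j ⟫)

    found : Eval p finder-program ⟪ e , J ⟫ 0
    found = subst (λ b → Eval p finder-program ⟪ e , J ⟫ (b2n (not b)))
              (dec-true (level (p J) ≟ 2 + e) at-J) (finder↓ J)

    earlier : ∀ z → z < J → Σ ℕ λ k → Eval p finder-program ⟪ e , z ⟫ (suc k)
    earlier z z<J = 0 , subst (λ b → Eval p finder-program ⟪ e , z ⟫ (b2n (not b)))
                          (dec-false (level (p z) ≟ 2 + e) (before-J z z<J)) (finder↓ z)

  halting-reducible : RecursiveIn HaltingSet p
  halting-reducible = decide-halting , λ e →
      (λ h → subst (Eval p decide-halting e) (cong (b2n ∘ not) (dec-false (_ ≟ 0) (FirstVisit.halting e h)))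
               (decide-halting-runs e))
    , (λ ¬h → subst (Eval p decide-halting e) (cong (b2n ∘ not) (dec-true (_ ≟ 0) (FirstVisit.not-halting e ¬h)))
                (decide-halting-runs e))

corollary20 : Σ Graph (λ G → RecursiveGraph G × PreEulerian G ×
                (∀ (p : ℕ → ℕ) → EulerPath G p → RecursiveIn HaltingSet p))
corollary20 = G , G-recursive , G-pre-Eulerian , λ p euler → EulerPathOf.halting-reducible p euler
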